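{- The family $\mathcal{BWTSL}=(\mathcal{BWTSL}(n))_{n\ge1}$ of labelled red and white trees, endowed with the compositions $\circ_x$ and the natural actions of the symmetric groups (by permuting labels), is a symmetric set-operad.
   Context: A red and white tree of weight $n$ is a rooted tree with no order on the children of a node, each node carrying a (possibly empty) set of labels, such that the label sets are pairwise disjoint with union $\{1,\dots,n\}$, and every node with empty label set has at least two children. Nodes are coloured: a node with non-empty label set is white; a node with empty label set is red if and only if all its children are white, and white otherwise. $\mathcal{BWTSL}(n)$ is the set of such trees of weight $n$; $S_n$ acts by permuting labels. Composition: let $T_1\in\mathcal{BWTSL}(m)$, $T_2\in\mathcal{BWTSL}(k)$ and $x$ a label of $T_1$ lying in node $z$. First renumber: labels $y>x$ of $T_1$ become $y+k-1$, and all labels of $T_2$ are increased by $x-1$. Then $T_1\circ_x T_2$ is: (W) if the root of $T_2$ is not red: erase $x$ from $z$, add the labels of the root of $T_2$ to $z$, and make the children of the root of $T_2$ children of $z$; (R) if the root of $T_2$ is red: (R1) if $T_1$ is the one-node tree labelled $\{x\}$, the result is $T_2$; (R2) if $z$ is not a leaf, or $z$ is a leaf with at least two labels, remove $x$ from $z$ and attach the root of $T_2$ as a new child of $z$; (R3) otherwise ($z$ is a leaf, not the root, with $x$ its only label), let $z'$ be the parent of $z$; remove the leaf $z$ and make all children of the root of $T_2$ new children of $z'$. In all cases, if $z$ has no remaining labels it is coloured white. -}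

module Defs where

open import Data.Nat using (ℕ; zero; suc; _+_; _∸_; _≤_; _<_; _≟_; _<?_)
open import Data.Bool using (Bool; true; false; not; _∧_; _∨_; if_then_else_)
open import Data.List using (List; []; _∷_; _++_; map; length; upTo)
open import Data.List.Relation.Unary.All using (All)
open import Data.List.Relation.Binary.Permutation.Propositional using (_↭_)
open import Data.List.Relation.Binary.Permutation.Homogeneous using (Permutation)
open import Data.Fin using (Fin; toℕ; fromℕ<)
open import Data.Fin.Permutation using (_⟨$⟩ʳ_) renaming (Permutation′ to Perm)
open import Data.Product using (_×_)
open import Relation.Binary.PropositionalEquality using (_≡_)
open import Relation.Nullary using (does; yes; no)

-- Raw rooted trees: each node carries a list of labels (read as a set)
-- and a list of children (read as a multiset: children are unordered).

data Tree : Set where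
  node : List ℕ → List Tree → Tree

rootLabels : Tree → List ℕ
rootLabels (node L C) = L

children : Tree → List Tree
children (node L C) = C

-- BWTSL(n) is the set of valid trees of weight n modulo this relation.
infix 4 _≅_
data _≅_ : Tree → Tree → Set where
  node≅ : ∀ {L L′ C C′} → L ↭ L′ → Permutation _≅_ C C′ → node L C ≅ node L′ C′

mutual
  labels : Tree → List ℕ
  labels (node L C) = L ++ labelsF C

  labelsF : List Tree → List ℕ
  labelsF [] = []
  labelsF (t ∷ ts) = labels t ++ labelsF ts

data Branching : Tree → Set where
  branching : ∀ {L C} → (L ≡ [] → 2 ≤ length C) → All Branching C → Branching (node L C)

oneTo : ℕ → List ℕ
oneTo n = map suc (upTo n)

-- T is a red and white tree of weight n: the label sets are pairwise
-- disjoint with union {1,…,n}, and empty-labelled nodes branch.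
BWTSL : ℕ → Tree → Set
BWTSL n T = (labels T ↭ oneTo n) × Branching T

mutual
  isRed : Tree → Bool
  isRed (node [] C) = allWhite C
  isRed (node (_ ∷ _) C) = false

  allWhite : List Tree → Bool
  allWhite [] = true
  allWhite (t ∷ ts) = not (isRed t) ∧ allWhite ts

mutual
  relabel : (ℕ → ℕ) → Tree → Tree
  relabel f (node L C) = node (map f L) (relabelF f C)

  relabelF : (ℕ → ℕ) → List Tree → List Tree
  relabelF f [] = []
  relabelF f (t ∷ ts) = relabel f t ∷ relabelF f ts

-- Symmetric group action: σ ∈ S_n sends label i ∈ {1,…,n} to σ(i).

permLabel : ∀ {n} → Perm n → ℕ → ℕ
permLabel {n} σ zero = zero
permLabel {n} σ (suc i) with i <? n
... | yes p = suc (toℕ (σ ⟨$⟩ʳ fromℕ< p))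
... | no _ = suc i

act : ∀ {n} → Perm n → Tree → Tree
act σ T = relabel (permLabel σ) T

elem : ℕ → List ℕ → Bool
elem x [] = false
elem x (y ∷ ys) = does (y ≟ x) ∨ elem x ys

del : ℕ → List ℕ → List ℕ
del x [] = []
del x (y ∷ ys) = if does (y ≟ x) then del x ys else (y ∷ del x ys)

isLeafX : ℕ → Tree → Bool
isLeafX x (node (y ∷ []) []) = does (y ≟ x)
isLeafX x _ = false

shiftAbove : ℕ → ℕ → ℕ → ℕ
shiftAbove x k y with x <? y
... | yes _ = y + k ∸ 1
... | no _ = y

-- case (W): root of T₂ (labels L₂, children C₂) merged into the node z ∋ x
mutual
  substW : ℕ → List ℕ → List Tree → Tree → Tree
  substW x L₂ C₂ (node L C) =
    if elem x L then node (del x L ++ L₂) (C ++ C₂)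
                else node L (substWF x L₂ C₂ C)

  substWF : ℕ → List ℕ → List Tree → List Tree → List Tree
  substWF x L₂ C₂ [] = []
  substWF x L₂ C₂ (t ∷ ts) = substW x L₂ C₂ t ∷ substWF x L₂ C₂ ts

-- cases (R2)/(R3): T₂ with red root
mutual
  substR : ℕ → Tree → Tree → Tree
  substR x T₂ (node L C) =
    if elem x L then node (del x L) (C ++ (T₂ ∷ []))   -- (R2)
                else node L (substRF x T₂ C)

  substRF : ℕ → Tree → List Tree → List Tree
  substRF x T₂ [] = []
  substRF x T₂ (t ∷ ts) =
    if isLeafX x t then children T₂ ++ substRF x T₂ ts   -- (R3): t = z, current node = z′
                   else substR x T₂ t ∷ substRF x T₂ ts

compose : Tree → ℕ → ℕ → Tree → Tree
compose T₁ x k T₂ =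
  if isRed T₂′
    then (if isLeafX x T₁ then T₂′ else substR x T₂′ T₁′)    -- (R1) / (R2),(R3)
    else substW x (rootLabels T₂′) (children T₂′) T₁′        -- (W)
  where
    T₁′ = relabel (shiftAbove x k) T₁
    T₂′ = relabel (λ y → y + x ∸ 1) T₂

unitTree : Tree
unitTree = node (1 ∷ []) []

-- the label map of the permutation σ ∘ₓ τ ∈ S_{m+k-1}
-- (block substitution of τ ∈ S_k into σ ∈ S_m at position x)
blockLabel : ∀ {m k} → Perm m → ℕ → Perm k → ℕ → ℕ
blockLabel {m} {k} σ x τ y with y <? x | y <? x + k
... | yes _ | _     = shiftAbove (permLabel σ x) k (permLabel σ y)
... | no _  | yes _ = permLabel τ (y ∸ x + 1) + permLabel σ x ∸ 1
... | no _  | no _  = shiftAbove (permLabel σ x) k (permLabel σ (y ∸ (k ∸ 1)))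

-- The symmetric set-operad axioms for (BWTSL, compose, act),
-- with equality in BWTSL(n) being tree isomorphism _≅_.

record IsSymmetricSetOperad : Set where
  field
    act-closed : ∀ {n} (σ : Perm n) {T} → BWTSL n T → BWTSL n (act σ T)
    act-cong   : ∀ {n} (σ : Perm n) {T T′} → BWTSL n T → T ≅ T′ → act σ T ≅ act σ T′
    act-id     : ∀ {n} {T} → BWTSL n T → act (Data.Fin.Permutation.id {n}) T ≅ T
    act-∘      : ∀ {n} (σ τ : Perm n) {T} → BWTSL n T →
                   act (σ Data.Fin.Permutation.∘ₚ τ) T ≅ act τ (act σ T)
    comp-closed : ∀ {m k T₁ T₂ x} → BWTSL m T₁ → BWTSL k T₂ → 1 ≤ x → x ≤ m →
                    BWTSL (m + k ∸ 1) (compose T₁ x k T₂)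
    comp-cong   : ∀ {m k T₁ T₁′ T₂ T₂′ x} → BWTSL m T₁ → BWTSL k T₂ → 1 ≤ x → x ≤ m →
                    T₁ ≅ T₁′ → T₂ ≅ T₂′ → compose T₁ x k T₂ ≅ compose T₁′ x k T₂′
    unit-valid : BWTSL 1 unitTree
    unit-left  : ∀ {k T} → BWTSL k T → compose unitTree 1 k T ≅ T
    unit-right : ∀ {m T x} → BWTSL m T → 1 ≤ x → x ≤ m → compose T x 1 unitTree ≅ T
    assoc-seq  : ∀ {m k l T₁ T₂ T₃ x y} → BWTSL m T₁ → BWTSL k T₂ → BWTSL l T₃ →
                   1 ≤ x → x ≤ m → x ≤ y → y < x + k →
                   compose (compose T₁ x k T₂) y l T₃
                     ≅ compose T₁ x (k + l ∸ 1) (compose T₂ (y ∸ x + 1) l T₃)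
    assoc-par  : ∀ {m k l T₁ T₂ T₃ x y} → BWTSL m T₁ → BWTSL k T₂ → BWTSL l T₃ →
                   1 ≤ x → x < y → y ≤ m →
                   compose (compose T₁ x k T₂) (y + k ∸ 1) l T₃
                     ≅ compose (compose T₁ y l T₃) x k T₂
    equivariance : ∀ {m k T₁ T₂ x} (σ : Perm m) (τ : Perm k) →
                   BWTSL m T₁ → BWTSL k T₂ → 1 ≤ x → x ≤ m →
                   compose (act σ T₁) (permLabel σ x) k (act τ T₂)
                     ≅ relabel (blockLabel σ x τ) (compose T₁ x k T₂)

module Submission where

-- A composition  compose T₁ x k T₂  renumbers both trees (shiftAbove x k on T₁,
-- offset x on T₂) and then performs the purely structural operation
-- graft x S T, which inserts S at the label x of T following the cases (W),
-- (R1), (R2), (R3).  Every operad axiom reduces to four properties of graft,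
-- each proved by induction on the host tree:
--   labels-graft, branching-graft   graft removes x, adds the labels of S and
--                                   keeps trees branching          (closure);
--   relabel-graft                   graft commutes with relabellings that
--                                   respect x          (units, equivariance);
--   graft-sequential                grafting into a grafted tree
--                                                (sequential associativity);
--   graft-parallel                  grafts at distinct labels commute up to
--                                   isomorphism        (parallel associativity).

open import Defs
open import Data.Nat using (ℕ; zero; suc; _+_; _∸_; _≤_; _<_; _≟_; _<?_; _≤?_; _≡ᵇ_; z≤n; s≤s; s≤s⁻¹)
open import Data.Nat.Properties
  using ( +-assoc; +-comm; +-suc; +-identityʳ; +-cancelʳ-≡; +-cancelˡ-<; +-mono-≤; +-monoʳ-≤; +-monoˡ-≤; +-monoˡ-<
        ; 0≢1+n; suc-injective; m+[n∸m]≡n; m+n∸m≡n; m+n∸n≡m; m≤m+n; m≤n+m; n≤1+n; ≡ᵇ⇒≡; ≡⇒≡ᵇ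
        ; ≤-refl; ≤-reflexive; ≤-trans; <-≤-trans; ≤-<-trans; <⇒≢; <⇒≤; <⇒≱; ≤∧≢⇒<; ≰⇒> )
open import Data.Bool using (T; Bool; true; false; not; _∧_; _∨_; if_then_else_)
open import Data.Bool.Properties using (∨-assoc; ∧-assoc; ∨-identityʳ)
open import Data.List using (List; []; _∷_; _++_; map; length; applyUpTo)
open import Data.List.Properties using (map-++; ++-assoc; length-++; ++-identityʳ; length-map; map-applyUpTo; map-cong-local; map-∘; map-id)
open import Data.List.Relation.Unary.All as All using (All; []; _∷_)
open import Data.List.Relation.Unary.All.Properties as AllP using (++⁻ˡ; ++⁻ʳ; ++⁺)
open import Data.List.Relation.Binary.Pointwise using (Pointwise; []; _∷_)
import Data.List.Relation.Binary.Permutation.Homogeneous as H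
open import Data.List.Relation.Binary.Permutation.Propositional as PP using (_↭_; ↭-refl; ↭-sym; ↭-trans; ↭-reflexive)
import Data.List.Relation.Binary.Permutation.Propositional.Properties as PPP
import Data.List.Relation.Binary.Permutation.Setoid.Properties
import Relation.Binary.Reasoning.Setoid
open import Data.Fin using (toℕ; fromℕ<)
open import Data.Fin.Properties using (toℕ-fromℕ<; fromℕ<-toℕ; toℕ-injective; toℕ<n)
open import Data.Fin.Permutation using (_⟨$⟩ʳ_; _⟨$⟩ˡ_; inverseˡ) renaming (Permutation′ to Perm)
import Data.Fin.Permutation as FP
open import Data.Product using (_×_; _,_; proj₁; proj₂)
open import Data.Sum using (_⊎_; inj₁; inj₂)
open import Data.Unit using (⊤; tt)
open import Data.Empty using (⊥; ⊥-elim)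
open import Relation.Binary.Bundles using (Setoid)
open import Relation.Binary.PropositionalEquality using (_≡_; refl; sym; trans; cong; cong₂; subst; _≢_; ≢-sym; module ≡-Reasoning)
open import Relation.Nullary using (does; yes; no; ¬_)
open import Function using (_∘_)

infix 4 _~_

_~_ : List Tree → List Tree → Set
_~_ = H.Permutation _≅_

mutual
  ≅-refl : ∀ {t} → t ≅ t
  ≅-refl {node L C} = node≅ ↭-refl (H.refl pointwise-refl)

  pointwise-refl : ∀ {C} → Pointwise _≅_ C C
  pointwise-refl {[]} = []
  pointwise-refl {t ∷ C} = ≅-refl ∷ pointwise-refl

mutual
  ≅-sym : ∀ {s t} → s ≅ t → t ≅ s
  ≅-sym (node≅ p q) = node≅ (↭-sym p) (~-sym q)

  ~-sym : ∀ {C D} → C ~ D → D ~ C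
  ~-sym (H.refl pw) = H.refl (pointwise-sym pw)
  ~-sym (H.prep e q) = H.prep (≅-sym e) (~-sym q)
  ~-sym (H.swap e f q) = H.swap (≅-sym f) (≅-sym e) (~-sym q)
  ~-sym (H.trans p q) = H.trans (~-sym q) (~-sym p)

  pointwise-sym : ∀ {C D} → Pointwise _≅_ C D → Pointwise _≅_ D C
  pointwise-sym [] = []
  pointwise-sym (e ∷ pw) = ≅-sym e ∷ pointwise-sym pw

≅-trans : ∀ {s t u} → s ≅ t → t ≅ u → s ≅ u
≅-trans (node≅ p q) (node≅ p′ q′) = node≅ (↭-trans p p′) (H.trans q q′)

≡⇒≅ : ∀ {s t} → s ≡ t → s ≅ t
≡⇒≅ refl = ≅-refl

~-refl : ∀ {C} → C ~ C
~-refl = H.refl pointwise-refl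

~-reflexive : ∀ {C D} → C ≡ D → C ~ D
~-reflexive refl = ~-refl

~-subst₂ : ∀ {A B C D} → A ≡ B → C ≡ D → B ~ D → A ~ C
~-subst₂ refl refl p = p

TreeSetoid : Setoid _ _
TreeSetoid = record { Carrier = Tree ; _≈_ = _≅_ ;
  isEquivalence = record { refl = ≅-refl ; sym = ≅-sym ; trans = ≅-trans } }

module TreePerm = Data.List.Relation.Binary.Permutation.Setoid.Properties TreeSetoid

module ≅-Reasoning = Relation.Binary.Reasoning.Setoid TreeSetoid

~-swap-last : ∀ (a n c : List Tree) → (a ++ n) ++ c ~ (a ++ c) ++ n
~-swap-last a n c = H.trans (~-reflexive (++-assoc a n c))
              (H.trans (TreePerm.++⁺ˡ a (TreePerm.++-comm n c)) (~-reflexive (sym (++-assoc a c n))))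

node≅-≡ : ∀ {A B L C L′ C′} → A ≡ node L C → B ≡ node L′ C′ → L ↭ L′ → C ~ C′ → A ≅ B
node≅-≡ refl refl p q = node≅ p q

children-≅ : ∀ {S S′} → S ≅ S′ → children S ~ children S′
children-≅ (node≅ p q) = q

rootLabels-≅ : ∀ {S S′} → S ≅ S′ → rootLabels S ↭ rootLabels S′
rootLabels-≅ (node≅ p q) = p

~-empty : ∀ {C D} → C ~ D → C ≡ [] → D ≡ []
~-empty {C} {D} p e with D | TreePerm.xs↭ys⇒|xs|≡|ys| p
... | [] | _ = refl
~-empty {[]} p e | _ ∷ _ | ()

-- Membership and deletion on label lists.  Defs decides label equality
-- through the Boolean test _≡ᵇ_, so these facts are stated about the
-- Boolean-valued functions elem and del.

data EqView (y x : ℕ) : Bool → Set where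
  equal : y ≡ x → EqView y x true
  unequal : y ≢ x → EqView y x false

≡ᵇ-view : ∀ y x → EqView y x (y ≡ᵇ x)
≡ᵇ-view y x with y ≡ᵇ x in e
... | true = equal (≡ᵇ⇒≡ y x (subst T (sym e) tt))
... | false = unequal (λ p → subst T e (≡⇒≡ᵇ y x p))

≡ᵇ-true : ∀ {y x} → y ≡ x → (y ≡ᵇ x) ≡ true
≡ᵇ-true {y} {x} p with y ≡ᵇ x | ≡ᵇ-view y x
... | true | _ = refl
... | false | unequal q = ⊥-elim (q p)

≡ᵇ-false : ∀ {y x} → y ≢ x → (y ≡ᵇ x) ≡ false
≡ᵇ-false {y} {x} p with y ≡ᵇ x | ≡ᵇ-view y x
... | true | equal q = ⊥-elim (p q)
... | false | _ = refl

≡ᵇ-sym : ∀ a b → (a ≡ᵇ b) ≡ (b ≡ᵇ a)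
≡ᵇ-sym a b with a ≡ᵇ b | ≡ᵇ-view a b | b ≡ᵇ a | ≡ᵇ-view b a
... | true | _ | true | _ = refl
... | false | _ | false | _ = refl
... | true | equal p | false | unequal q = ⊥-elim (q (sym p))
... | false | unequal p | true | equal q = ⊥-elim (p (sym q))

true≢false : true ≡ false → ⊥
true≢false ()

∨-false⁻ : ∀ a b → a ∨ b ≡ false → (a ≡ false) × (b ≡ false)
∨-false⁻ false b e = refl , e

∨-trueʳ : ∀ a b → b ≡ true → a ∨ b ≡ true
∨-trueʳ false b e = e
∨-trueʳ true b e = refl

∧-trueʳ : ∀ a b → a ∧ b ≡ true → b ≡ true
∧-trueʳ true b e = e

∧-swap : ∀ a b c → a ∧ (b ∧ c) ≡ b ∧ (a ∧ c)
∧-swap false false c = refl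
∧-swap false true c = refl
∧-swap true b c = refl

∨-swap : ∀ a b c → a ∨ (b ∨ c) ≡ b ∨ (a ∨ c)
∨-swap false b c = refl
∨-swap true false c = refl
∨-swap true true c = refl

-- Case analysis on a Boolean expression without abstracting it in the goal
-- (useful when the goal mentions a function that unfolds to an if-then-else).
by-cases : ∀ {P : Set} (b : Bool) → (b ≡ true → P) → (b ≡ false → P) → P
by-cases true  t f = t refl
by-cases false t f = f refl

elem-++ : ∀ x xs ys → elem x (xs ++ ys) ≡ elem x xs ∨ elem x ys
elem-++ x [] ys = refl
elem-++ x (y ∷ xs) ys = trans (cong (does (y ≟ x) ∨_) (elem-++ x xs ys)) (sym (∨-assoc (does (y ≟ x)) (elem x xs) (elem x ys)))

elem-++-false⁻ : ∀ x xs ys → elem x (xs ++ ys) ≡ false → (elem x xs ≡ false) × (elem x ys ≡ false)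
elem-++-false⁻ x xs ys e = ∨-false⁻ _ _ (trans (sym (elem-++ x xs ys)) e)

elem-++-true-right : ∀ x xs ys → elem x (xs ++ ys) ≡ true → elem x xs ≡ false → elem x ys ≡ true
elem-++-true-right x xs ys e f = trans (sym (cong (_∨ elem x ys) f)) (trans (sym (elem-++ x xs ys)) e)

elem-cong : ∀ x {L L′} → L ↭ L′ → elem x L ≡ elem x L′
elem-cong x PP.refl = refl
elem-cong x (PP.prep y p) = cong ((y ≡ᵇ x) ∨_) (elem-cong x p)
elem-cong x (PP.swap y z p) = trans (∨-swap (y ≡ᵇ x) (z ≡ᵇ x) _) (cong (λ r → (z ≡ᵇ x) ∨ ((y ≡ᵇ x) ∨ r)) (elem-cong x p))
elem-cong x (PP.trans p q) = trans (elem-cong x p) (elem-cong x q)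

↭-empty : ∀ {L L′ : List ℕ} → L ↭ L′ → L ≡ [] → L′ ≡ []
↭-empty p refl = PPP.↭-empty-inv (↭-sym p)

del-++ : ∀ x xs ys → del x (xs ++ ys) ≡ del x xs ++ del x ys
del-++ x [] ys = refl
del-++ x (y ∷ xs) ys with does (y ≟ x)
... | true = del-++ x xs ys
... | false = cong (y ∷_) (del-++ x xs ys)

del-notin : ∀ x xs → elem x xs ≡ false → del x xs ≡ xs
del-notin x [] e = refl
del-notin x (y ∷ xs) e with y ≡ᵇ x | ≡ᵇ-view y x
... | true | _ = ⊥-elim (true≢false e)
... | false | _ = cong (y ∷_) (del-notin x xs e)

elem-del-self : ∀ x xs → elem x (del x xs) ≡ false
elem-del-self x [] = refl
elem-del-self x (y ∷ xs) with y ≡ᵇ x | ≡ᵇ-view y x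
... | true | _ = elem-del-self x xs
... | false | unequal p with y ≡ᵇ x | ≡ᵇ-view y x
... | true | equal q = ⊥-elim (p q)
... | false | _ = elem-del-self x xs

elem-del-other : ∀ x z xs → z ≢ x → elem z (del x xs) ≡ elem z xs
elem-del-other x z [] n = refl
elem-del-other x z (y ∷ xs) n with y ≡ᵇ x | ≡ᵇ-view y x
... | true | equal refl with y ≡ᵇ z | ≡ᵇ-view y z
... | true | equal refl = ⊥-elim (n refl)
... | false | _ = elem-del-other x z xs n
elem-del-other x z (y ∷ xs) n | false | _ with y ≡ᵇ z
... | true = refl
... | false = elem-del-other x z xs n

elem-del-++-other : ∀ x y L L₂ → y ≢ x → elem y L₂ ≡ false → elem y (del x L ++ L₂) ≡ elem y L
elem-del-++-other x y L L₂ n e = trans (elem-++ y (del x L) L₂) (trans (cong₂ _∨_ (elem-del-other x y L n) e) (∨-identityʳ (elem y L)))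

elem-del-++-false⁻ : ∀ x y L M → elem y (del x (L ++ M)) ≡ false → (elem y (del x L) ≡ false) × (elem y (del x M) ≡ false)
elem-del-++-false⁻ x y L M h = elem-++-false⁻ y (del x L) (del x M) (trans (cong (elem y) (sym (del-++ x L M))) h)

elem-del-absent : ∀ x y L → elem x L ≡ false → elem y (del x L) ≡ false → elem y L ≡ false
elem-del-absent x y L e h = trans (cong (elem y) (sym (del-notin x L e))) h

del-comm : ∀ x y L → del y (del x L) ≡ del x (del y L)
del-comm x y [] = refl
del-comm x y (a ∷ L) with a ≡ᵇ x | ≡ᵇ-view a x | a ≡ᵇ y | ≡ᵇ-view a y
... | true | _ | true | _ = del-comm x y L
... | true | equal refl | false | _ rewrite ≡ᵇ-true {a} {a} refl = del-comm x y L
... | false | _ | true | equal refl rewrite ≡ᵇ-true {a} {a} refl = del-comm x y L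
... | false | unequal p | false | unequal q rewrite ≡ᵇ-false p | ≡ᵇ-false q = cong (a ∷_) (del-comm x y L)

del-cong : ∀ x {L L′} → L ↭ L′ → del x L ↭ del x L′
del-cong x PP.refl = ↭-refl
del-cong x (PP.prep y p) with y ≡ᵇ x
... | true = del-cong x p
... | false = PP.prep y (del-cong x p)
del-cong x (PP.swap y z p) with y ≡ᵇ x | z ≡ᵇ x
... | true | true = del-cong x p
... | true | false = PP.prep z (del-cong x p)
... | false | true = PP.prep y (del-cong x p)
... | false | false = PP.swap y z (del-cong x p)
del-cong x (PP.trans p q) = ↭-trans (del-cong x p) (del-cong x q)

elem-map-true : ∀ (f : ℕ → ℕ) z L → elem z L ≡ true → elem (f z) (map f L) ≡ true
elem-map-true f z (w ∷ L) e with w ≡ᵇ z | ≡ᵇ-view w z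
... | true | equal refl rewrite ≡ᵇ-true {f w} {f w} refl = refl
... | false | _ = ∨-trueʳ _ _ (elem-map-true f z L e)

elem-map-false : ∀ (f : ℕ → ℕ) z L → All (λ w → f w ≢ z) L → elem z (map f L) ≡ false
elem-map-false f z [] [] = refl
elem-map-false f z (w ∷ L) (n ∷ a) rewrite ≡ᵇ-false n = elem-map-false f z L a

all≢⇒elem-false : ∀ z L → All (λ w → w ≢ z) L → elem z L ≡ false
all≢⇒elem-false z [] [] = refl
all≢⇒elem-false z (w ∷ L) (n ∷ a) rewrite ≡ᵇ-false n = all≢⇒elem-false z L a

elem-false⇒all≢ : ∀ a xs → elem a xs ≡ false → All (λ z → z ≢ a) xs
elem-false⇒all≢ a [] e = []
elem-false⇒all≢ a (z ∷ xs) e with z ≡ᵇ a | ≡ᵇ-view z a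
... | false | unequal n = n ∷ elem-false⇒all≢ a xs e

++-conicalʳ : ∀ (xs ys : List ℕ) → xs ++ ys ≡ [] → ys ≡ []
++-conicalʳ [] ys e = e
++-conicalʳ (_ ∷ _) ys ()

map-conical : ∀ {f : ℕ → ℕ} L → map f L ≡ [] → L ≡ []
map-conical [] e = refl
map-conical (x ∷ L) ()

↭-middle-swap : ∀ (a b c d : List ℕ) → (a ++ b) ++ (c ++ d) ↭ (a ++ c) ++ (b ++ d)
↭-middle-swap a b c d = ↭-trans (↭-reflexive (++-assoc a b (c ++ d)))
               (↭-trans (PPP.++⁺ˡ a (PPP.shifts b c))
               (↭-reflexive (sym (++-assoc a c (b ++ d)))))

↭-swap-last : ∀ (a n c : List ℕ) → (a ++ n) ++ c ↭ (a ++ c) ++ n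
↭-swap-last a n c = ↭-trans (↭-reflexive (++-assoc a n c))
              (↭-trans (PPP.++⁺ˡ a (PPP.++-comm n c)) (↭-reflexive (sym (++-assoc a c n))))

↭-rotate : ∀ (a n c : List ℕ) → (a ++ n) ++ c ↭ a ++ (c ++ n)
↭-rotate a n c = ↭-trans (↭-reflexive (++-assoc a n c)) (PPP.++⁺ˡ a (PPP.++-comm n c))

Distinct : List ℕ → Set
Distinct [] = ⊤
Distinct (y ∷ ys) = (elem y ys ≡ false) × Distinct ys

Distinct-++ˡ : ∀ xs ys → Distinct (xs ++ ys) → Distinct xs
Distinct-++ˡ [] ys u = tt
Distinct-++ˡ (y ∷ xs) ys (e , u) = proj₁ (∨-false⁻ _ _ (trans (sym (elem-++ y xs ys)) e)) , Distinct-++ˡ xs ys u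

Distinct-++ʳ : ∀ xs ys → Distinct (xs ++ ys) → Distinct ys
Distinct-++ʳ [] ys u = u
Distinct-++ʳ (y ∷ xs) ys (e , u) = Distinct-++ʳ xs ys u

Distinct-disjoint : ∀ z xs ys → Distinct (xs ++ ys) → elem z xs ≡ true → elem z ys ≡ false
Distinct-disjoint z [] ys u ()
Distinct-disjoint z (y ∷ xs) ys (e , u) h with y ≡ᵇ z | ≡ᵇ-view y z
... | true | equal refl = proj₂ (∨-false⁻ _ _ (trans (sym (elem-++ y xs ys)) e))
... | false | _ = Distinct-disjoint z xs ys u h

Distinct-↭ : ∀ {L L′} → L ↭ L′ → Distinct L → Distinct L′
Distinct-↭ PP.refl u = u
Distinct-↭ (PP.prep x p) (e , u) = trans (sym (elem-cong x p)) e , Distinct-↭ p u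
Distinct-↭ (PP.swap x y p) (e₁ , e₂ , u) =
  let (a , b) = ∨-false⁻ _ _ e₁ in
  cong₂ _∨_ (trans (≡ᵇ-sym x y) a) (trans (sym (elem-cong y p)) e₂) ,
  trans (sym (elem-cong x p)) b , Distinct-↭ p u
Distinct-↭ (PP.trans p q) u = Distinct-↭ q (Distinct-↭ p u)

Distinct-map : ∀ (f : ℕ → ℕ) L → (∀ a b → f a ≡ f b → a ≡ b) → Distinct L → Distinct (map f L)
Distinct-map f [] inj u = tt
Distinct-map f (w ∷ L) inj (e , u) = notIn L e , Distinct-map f L inj u
  where
    notIn : ∀ L → elem w L ≡ false → elem (f w) (map f L) ≡ false
    notIn [] e = refl
    notIn (v ∷ L) e with v ≡ᵇ w | ≡ᵇ-view v w
    ... | false | unequal ne with f v ≡ᵇ f w | ≡ᵇ-view (f v) (f w)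
    ...   | true | equal q = ⊥-elim (ne (inj v w q))
    ...   | false | _ = notIn L e

Distinct-del : ∀ x L → Distinct L → Distinct (del x L)
Distinct-del x [] u = tt
Distinct-del x (y ∷ L) (e , u) with y ≡ᵇ x | ≡ᵇ-view y x
... | true | _ = Distinct-del x L u
... | false | unequal y≢x = trans (elem-del-other x y L y≢x) e , Distinct-del x L u

del≡[] : ∀ x L → Distinct L → elem x L ≡ true → del x L ≡ [] → L ≡ x ∷ []
del≡[] x (y ∷ L) (n , u) e d with y ≡ᵇ x | ≡ᵇ-view y x
del≡[] x (y ∷ L) (n , u) e d | true | equal refl = cong (y ∷_) (trans (sym (del-notin y L n)) d)
del≡[] x (y ∷ L) (n , u) e () | false | _

↭-del : ∀ x L → Distinct L → elem x L ≡ true → L ↭ x ∷ del x L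
↭-del x (y ∷ L) (n , u) e with y ≡ᵇ x | ≡ᵇ-view y x
... | true | equal refl = PP.prep y (↭-reflexive (sym (del-notin y L n)))
... | false | _ = ↭-trans (PP.prep y (↭-del x L u e)) (PP.swap y x ↭-refl)

distinct-↭ : ∀ xs ys → Distinct xs → Distinct ys → length xs ≡ length ys → All (λ z → elem z ys ≡ true) xs → xs ↭ ys
distinct-↭ [] [] u v l a = ↭-refl
distinct-↭ (x ∷ xs) ys (e , u) v l (px ∷ a) =
  ↭-trans (PP.prep x (distinct-↭ xs (del x ys) u (Distinct-del x ys v) len
           (All.zipWith (λ { (n , q) → trans (elem-del-other x _ ys n) q }) (elem-false⇒all≢ x xs e , a))))
          (↭-sym perm)
  where
    perm = ↭-del x ys v px
    len : length xs ≡ length (del x ys)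
    len = suc-injective (trans l (PPP.↭-length perm))

mutual
  labels-relabel : ∀ f T → labels (relabel f T) ≡ map f (labels T)
  labels-relabel f (node L C) = trans (cong (map f L ++_) (labelsF-relabel f C)) (sym (map-++ f L (labelsF C)))

  labelsF-relabel : ∀ f C → labelsF (relabelF f C) ≡ map f (labelsF C)
  labelsF-relabel f [] = refl
  labelsF-relabel f (t ∷ C) = trans (cong₂ _++_ (labels-relabel f t) (labelsF-relabel f C)) (sym (map-++ f (labels t) (labelsF C)))

elem-relabel : ∀ f T z → elem z (labels T) ≡ true → elem (f z) (labels (relabel f T)) ≡ true
elem-relabel f T z e = subst (λ L → elem (f z) L ≡ true) (sym (labels-relabel f T)) (elem-map-true f z (labels T) e)

elem-relabel-missed : ∀ f (P : ℕ → Set) T w → All P (labels T) → (∀ z → P z → f z ≢ w) →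
                      elem w (labels (relabel f T)) ≡ false
elem-relabel-missed f P T w a h =
  subst (λ L → elem w L ≡ false) (sym (labels-relabel f T)) (elem-map-false f w (labels T) (All.map (λ {z} → h z) a))

mutual
  relabel-ext : ∀ {f g} T → All (λ y → f y ≡ g y) (labels T) → relabel f T ≡ relabel g T
  relabel-ext (node L C) a = cong₂ node (map-cong-local (++⁻ˡ L a)) (relabelF-ext C (++⁻ʳ L a))

  relabelF-ext : ∀ {f g} C → All (λ y → f y ≡ g y) (labelsF C) → relabelF f C ≡ relabelF g C
  relabelF-ext [] a = refl
  relabelF-ext (t ∷ C) a = cong₂ _∷_ (relabel-ext t (++⁻ˡ (labels t) a)) (relabelF-ext C (++⁻ʳ (labels t) a))

mutual
  relabel-∘ : ∀ f g T → relabel f (relabel g T) ≡ relabel (f ∘ g) T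
  relabel-∘ f g (node L C) = cong₂ node (sym (map-∘ L)) (relabelF-∘ f g C)

  relabelF-∘ : ∀ f g C → relabelF f (relabelF g C) ≡ relabelF (f ∘ g) C
  relabelF-∘ f g [] = refl
  relabelF-∘ f g (t ∷ C) = cong₂ _∷_ (relabel-∘ f g t) (relabelF-∘ f g C)

mutual
  relabel-id : ∀ T → relabel (λ y → y) T ≡ T
  relabel-id (node L C) = cong₂ node (map-id L) (relabelF-id C)

  relabelF-id : ∀ C → relabelF (λ y → y) C ≡ C
  relabelF-id [] = refl
  relabelF-id (t ∷ C) = cong₂ _∷_ (relabel-id t) (relabelF-id C)

relabel-pointwise : ∀ (f g : ℕ → ℕ) T → (∀ z → f z ≡ g z) → relabel f T ≡ relabel g T
relabel-pointwise f g T h = relabel-ext T (All.universal h (labels T))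

relabel-∘-pointwise : ∀ (f g h : ℕ → ℕ) T → (∀ z → f (g z) ≡ h z) → relabel f (relabel g T) ≡ relabel h T
relabel-∘-pointwise f g h T e = trans (relabel-∘ f g T) (relabel-pointwise (f ∘ g) h T e)

relabel-on-labels : ∀ (f g : ℕ → ℕ) (P : ℕ → Set) T → All P (labels T) → (∀ z → P z → f z ≡ g z) → relabel f T ≡ relabel g T
relabel-on-labels f g P T a h = relabel-ext T (All.map (λ {z} → h z) a)

relabelF-++ : ∀ f C D → relabelF f (C ++ D) ≡ relabelF f C ++ relabelF f D
relabelF-++ f [] D = refl
relabelF-++ f (t ∷ C) D = cong (relabel f t ∷_) (relabelF-++ f C D)

labelsF-++ : ∀ C D → labelsF (C ++ D) ≡ labelsF C ++ labelsF D
labelsF-++ [] D = refl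
labelsF-++ (t ∷ C) D = trans (cong (labels t ++_) (labelsF-++ C D)) (sym (++-assoc (labels t) (labelsF C) (labelsF D)))

length-relabelF : ∀ f C → length (relabelF f C) ≡ length C
length-relabelF f [] = refl
length-relabelF f (t ∷ C) = cong suc (length-relabelF f C)

mutual
  isRed-relabel : ∀ f T → isRed (relabel f T) ≡ isRed T
  isRed-relabel f (node [] C) = allWhite-relabel f C
  isRed-relabel f (node (_ ∷ _) C) = refl

  allWhite-relabel : ∀ f C → allWhite (relabelF f C) ≡ allWhite C
  allWhite-relabel f [] = refl
  allWhite-relabel f (t ∷ C) = cong₂ (λ a b → not a ∧ b) (isRed-relabel f t) (allWhite-relabel f C)

mutual
  branching-relabel : ∀ f {T} → Branching T → Branching (relabel f T)
  branching-relabel f {node L C} (branching h a) =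
    branching (λ e → subst (2 ≤_) (sym (length-relabelF f C)) (h (map-conical L e))) (branchingF-relabel f a)

  branchingF-relabel : ∀ f {C} → All Branching C → All Branching (relabelF f C)
  branchingF-relabel f [] = []
  branchingF-relabel f (b ∷ a) = branching-relabel f b ∷ branchingF-relabel f a

mutual
  relabel-cong : ∀ f {s t} → s ≅ t → relabel f s ≅ relabel f t
  relabel-cong f (node≅ p q) = node≅ (PPP.map⁺ f p) (relabelF-~ f q)

  relabelF-~ : ∀ f {C D} → C ~ D → relabelF f C ~ relabelF f D
  relabelF-~ f (H.refl pw) = H.refl (relabelF-pointwise f pw)
  relabelF-~ f (H.prep e q) = H.prep (relabel-cong f e) (relabelF-~ f q)
  relabelF-~ f (H.swap e e′ q) = H.swap (relabel-cong f e) (relabel-cong f e′) (relabelF-~ f q)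
  relabelF-~ f (H.trans p q) = H.trans (relabelF-~ f p) (relabelF-~ f q)

  relabelF-pointwise : ∀ f {C D} → Pointwise _≅_ C D → Pointwise _≅_ (relabelF f C) (relabelF f D)
  relabelF-pointwise f [] = []
  relabelF-pointwise f (e ∷ pw) = relabel-cong f e ∷ relabelF-pointwise f pw

allWhite-++ : ∀ C D → allWhite (C ++ D) ≡ allWhite C ∧ allWhite D
allWhite-++ [] D = refl
allWhite-++ (t ∷ C) D = trans (cong (not (isRed t) ∧_) (allWhite-++ C D)) (sym (∧-assoc (not (isRed t)) (allWhite C) (allWhite D)))

isRed-inv : ∀ M D → isRed (node M D) ≡ true → (M ≡ []) × (allWhite D ≡ true)
isRed-inv [] D e = refl , e
isRed-inv (_ ∷ _) D ()

isRed-false : ∀ M D → ((M ≡ []) × (allWhite D ≡ true) → ⊥) → isRed (node M D) ≡ false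
isRed-false M D h with isRed (node M D) in e
... | false = refl
... | true = ⊥-elim (h (isRed-inv M D e))

isRed-node : ∀ L₂ C₂ → L₂ ≡ [] → allWhite C₂ ≡ true → isRed (node L₂ C₂) ≡ true
isRed-node [] C₂ refl w = w

isRed-labelled : ∀ x L C → elem x L ≡ true → isRed (node L C) ≡ false
isRed-labelled x (_ ∷ _) C e = refl

isLeafX⇒white : ∀ x t → isLeafX x t ≡ true → isRed t ≡ false
isLeafX⇒white x (node (y ∷ []) []) e = refl

red⇒children-white : ∀ S → isRed S ≡ true → allWhite (children S) ≡ true
red⇒children-white (node [] C) e = e

labels-red : ∀ S → isRed S ≡ true → labels S ≡ labelsF (children S)
labels-red (node [] C) e = refl

red-branching : ∀ S → Branching S → isRed S ≡ true → 2 ≤ length (children S)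
red-branching (node [] C) (branching h a) r = h refl

branching-children : ∀ S → Branching S → All Branching (children S)
branching-children (node L C) (branching h a) = a

mutual
  isRed-cong : ∀ {s t} → s ≅ t → isRed s ≡ isRed t
  isRed-cong {node [] C} {node [] D} (node≅ p q) = allWhite-cong q
  isRed-cong {node [] C} {node (_ ∷ _) D} (node≅ p q) with ↭-empty p refl
  ... | ()
  isRed-cong {node (_ ∷ _) C} {node [] D} (node≅ p q) with ↭-empty (↭-sym p) refl
  ... | ()
  isRed-cong {node (_ ∷ _) C} {node (_ ∷ _) D} (node≅ p q) = refl

  allWhite-cong : ∀ {C D} → C ~ D → allWhite C ≡ allWhite D
  allWhite-cong (H.refl pw) = allWhite-pw pw
  allWhite-cong (H.prep e q) = cong₂ (λ a b → not a ∧ b) (isRed-cong e) (allWhite-cong q)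
  allWhite-cong (H.swap {x = x} {y = y} {x′ = x′} {y′ = y′} e₁ e₂ q) =
    trans (∧-swap (not (isRed x)) (not (isRed y)) _)
      (cong₂ (λ a b → not a ∧ b) (isRed-cong e₂) (cong₂ (λ a b → not a ∧ b) (isRed-cong e₁) (allWhite-cong q)))
  allWhite-cong (H.trans p q) = trans (allWhite-cong p) (allWhite-cong q)

  allWhite-pw : ∀ {C D} → Pointwise _≅_ C D → allWhite C ≡ allWhite D
  allWhite-pw [] = refl
  allWhite-pw (e ∷ pw) = cong₂ (λ a b → not a ∧ b) (isRed-cong e) (allWhite-pw pw)

isLeafX-resp-≅ : ∀ x {s t} → s ≅ t → isLeafX x s ≡ true → isLeafX x t ≡ true
isLeafX-resp-≅ x {node (y ∷ []) []} {node L′ C′} (node≅ p q) l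
  rewrite PPP.↭-singleton-inv (↭-sym p) | ~-empty q refl = l

isLeafX-cong : ∀ x {s t} → s ≅ t → isLeafX x s ≡ isLeafX x t
isLeafX-cong x {s} {t} e with isLeafX x s in a | isLeafX x t in b
... | true | true = refl
... | false | false = refl
... | true | false = ⊥-elim (true≢false (trans (sym (isLeafX-resp-≅ x e a)) b))
... | false | true = ⊥-elim (true≢false (trans (sym (isLeafX-resp-≅ x (≅-sym e) b)) a))

isLeafX-self : ∀ x → isLeafX x (node (x ∷ []) []) ≡ true
isLeafX-self x = ≡ᵇ-true {x} {x} refl

isLeafX-red : ∀ y S → isRed S ≡ true → isLeafX y S ≡ false
isLeafX-red y (node [] C) r = refl

isLeafX-absent : ∀ x t → elem x (labels t) ≡ false → isLeafX x t ≡ false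
isLeafX-absent x (node [] C) e = refl
isLeafX-absent x (node (y ∷ []) []) e = proj₁ (∨-false⁻ _ _ e)
isLeafX-absent x (node (y ∷ []) (_ ∷ _)) e = refl
isLeafX-absent x (node (y ∷ _ ∷ _) C) e = refl

isLeafX-unlabelled : ∀ y L D → elem y L ≡ false → isLeafX y (node L D) ≡ false
isLeafX-unlabelled y [] D e = refl
isLeafX-unlabelled y (a ∷ []) [] e = proj₁ (∨-false⁻ _ _ e)
isLeafX-unlabelled y (a ∷ []) (_ ∷ _) e = refl
isLeafX-unlabelled y (a ∷ _ ∷ _) D e = refl

isLeafX-inner : ∀ x L c C → isLeafX x (node L (c ∷ C)) ≡ false
isLeafX-inner x [] c C = refl
isLeafX-inner x (_ ∷ []) c C = refl
isLeafX-inner x (_ ∷ _ ∷ _) c C = refl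

isLeafX-children : ∀ y L D → 1 ≤ length D → isLeafX y (node L D) ≡ false
isLeafX-children y L (d ∷ D) p = isLeafX-inner y L d D

isLeafX-merge : ∀ y M N D E → elem y M ≡ false → isLeafX y (node N E) ≡ false → isLeafX y (node (M ++ N) (D ++ E)) ≡ false
isLeafX-merge y [] N [] E m l = l
isLeafX-merge y [] [] (_ ∷ _) E m l = refl
isLeafX-merge y [] (_ ∷ []) (_ ∷ _) E m l = refl
isLeafX-merge y [] (_ ∷ _ ∷ _) (_ ∷ _) E m l = refl
isLeafX-merge y (a ∷ []) [] [] [] m l = proj₁ (∨-false⁻ _ _ m)
isLeafX-merge y (a ∷ []) [] [] (_ ∷ _) m l = refl
isLeafX-merge y (a ∷ []) [] (_ ∷ _) E m l = refl
isLeafX-merge y (a ∷ []) (_ ∷ _) D E m l = refl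
isLeafX-merge y (a ∷ _ ∷ _) N D E m l = refl

isLeafX-snoc : ∀ y M D s → isLeafX y (node M (D ++ s ∷ [])) ≡ false
isLeafX-snoc y [] D s = refl
isLeafX-snoc y (a ∷ []) [] s = refl
isLeafX-snoc y (a ∷ []) (_ ∷ _) s = refl
isLeafX-snoc y (a ∷ _ ∷ _) D s = refl

isLeafX-shape : ∀ y S → isLeafX y S ≡ true → S ≡ node (y ∷ []) []
isLeafX-shape y (node (a ∷ []) []) l = cong (λ b → node (b ∷ []) []) (≡ᵇ⇒≡ a y (subst T (sym l) tt))

isLeafX-del : ∀ x t → isLeafX x t ≡ true → del x (labels t) ≡ []
isLeafX-del x (node (y ∷ []) []) e rewrite e = refl

isLeafX-leaf-del : ∀ x L → isLeafX x (node L []) ≡ true → del x L ≡ []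
isLeafX-leaf-del x (y ∷ []) l rewrite l = refl

isLeafX-other : ∀ x y L C → elem x L ≡ true → x ≢ y → isLeafX y (node L C) ≡ false
isLeafX-other x y [] C ()
isLeafX-other x y (a ∷ []) [] e n with a ≡ᵇ x | ≡ᵇ-view a x
... | true | equal refl = ≡ᵇ-false n
isLeafX-other x y (a ∷ []) (_ ∷ _) e n = refl
isLeafX-other x y (a ∷ _ ∷ _) C e n = refl

isLeafX-unique : ∀ x y t → isLeafX x t ≡ true → x ≢ y → isLeafX y t ≡ false
isLeafX-unique x y (node (a ∷ []) []) l n with a ≡ᵇ x | ≡ᵇ-view a x
... | true | equal refl = ≡ᵇ-false n

isLeafX-other-absent : ∀ x y t → isLeafX x t ≡ true → x ≢ y → elem y (labels t) ≡ false
isLeafX-other-absent x y (node (a ∷ []) []) l n with a ≡ᵇ x | ≡ᵇ-view a x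
... | true | equal refl rewrite ≡ᵇ-false n = refl

isLeafX-labels : ∀ x y T → isLeafX x T ≡ true → elem y (labels T) ≡ true → x ≢ y → ⊥
isLeafX-labels x y (node (a ∷ []) []) l e n with a ≡ᵇ x | ≡ᵇ-view a x
... | true | equal refl rewrite ≡ᵇ-false n = true≢false (sym e)

labelled⇒¬isLeafX : ∀ x y T → elem y (labels T) ≡ true → x ≢ y → isLeafX x T ≡ false
labelled⇒¬isLeafX x y T e n with isLeafX x T in l
... | false = refl
... | true = ⊥-elim (isLeafX-labels x y T l e n)

graft : ℕ → Tree → Tree → Tree
graft x S T = if isRed S then (if isLeafX x T then S else substR x S T)
                       else substW x (rootLabels S) (children S) T

cong-graft : ∀ {x x′ S S′ T T′} → x ≡ x′ → S ≡ S′ → T ≡ T′ → graft x S T ≡ graft x′ S′ T′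
cong-graft refl refl refl = refl

substW-here : ∀ x L₂ C₂ L C → elem x L ≡ true → substW x L₂ C₂ (node L C) ≡ node (del x L ++ L₂) (C ++ C₂)
substW-here x L₂ C₂ L C e rewrite e = refl

substW-below : ∀ x L₂ C₂ L C → elem x L ≡ false → substW x L₂ C₂ (node L C) ≡ node L (substWF x L₂ C₂ C)
substW-below x L₂ C₂ L C e rewrite e = refl

substR-here : ∀ x S L C → elem x L ≡ true → substR x S (node L C) ≡ node (del x L) (C ++ (S ∷ []))
substR-here x S L C e rewrite e = refl

substR-below : ∀ x S L C → elem x L ≡ false → substR x S (node L C) ≡ node L (substRF x S C)
substR-below x S L C e rewrite e = refl

substRF-leaf : ∀ x S t C → isLeafX x t ≡ true → substRF x S (t ∷ C) ≡ children S ++ substRF x S C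
substRF-leaf x S t C e rewrite e = refl

substRF-nonleaf : ∀ x S t C → isLeafX x t ≡ false → substRF x S (t ∷ C) ≡ substR x S t ∷ substRF x S C
substRF-nonleaf x S t C e rewrite e = refl

graft-white : ∀ x S T → isRed S ≡ false → graft x S T ≡ substW x (rootLabels S) (children S) T
graft-white x S T r rewrite r = refl

graft-red-leaf : ∀ x S T → isRed S ≡ true → isLeafX x T ≡ true → graft x S T ≡ S
graft-red-leaf x S T r l rewrite r | l = refl

graft-red : ∀ x S T → isRed S ≡ true → isLeafX x T ≡ false → graft x S T ≡ substR x S T
graft-red x S T r l rewrite r | l = refl

substWF-++ : ∀ x L₂ C₂ C D → substWF x L₂ C₂ (C ++ D) ≡ substWF x L₂ C₂ C ++ substWF x L₂ C₂ D
substWF-++ x L₂ C₂ [] D = refl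
substWF-++ x L₂ C₂ (t ∷ C) D = cong (substW x L₂ C₂ t ∷_) (substWF-++ x L₂ C₂ C D)

substRF-++ : ∀ x S C D → substRF x S (C ++ D) ≡ substRF x S C ++ substRF x S D
substRF-++ x S [] D = refl
substRF-++ x S (t ∷ C) D with isLeafX x t
... | true = trans (cong (children S ++_) (substRF-++ x S C D)) (sym (++-assoc (children S) _ _))
... | false = cong (substR x S t ∷_) (substRF-++ x S C D)

children-substW-red : ∀ y L₃ C₃ S₂ → isRed S₂ ≡ true → children (substW y L₃ C₃ S₂) ≡ substWF y L₃ C₃ (children S₂)
children-substW-red y L₃ C₃ (node [] C₂) r = refl

children-substR-red : ∀ y S₃ S₂ → isRed S₂ ≡ true → children (substR y S₃ S₂) ≡ substRF y S₃ (children S₂)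
children-substR-red y S₃ (node [] C₂) r = refl

elem-rootLabels-absent : ∀ x S → elem x (labels S) ≡ false → elem x (rootLabels S) ≡ false
elem-rootLabels-absent x (node L C) e = proj₁ (elem-++-false⁻ x L (labelsF C) e)

elem-children-absent : ∀ x S → elem x (labels S) ≡ false → elem x (labelsF (children S)) ≡ false
elem-children-absent x (node L C) e = proj₂ (elem-++-false⁻ x L (labelsF C) e)

del-children-absent : ∀ x L C → Distinct (labels (node L C)) → elem x L ≡ true → del x (labelsF C) ≡ labelsF C
del-children-absent x L C u e = del-notin x (labelsF C) (Distinct-disjoint x L (labelsF C) u e)

elem-del-children : ∀ x y L C → Distinct (labels (node L C)) → elem x L ≡ true → elem y (del x (labels (node L C))) ≡ false → elem y (labelsF C) ≡ false
elem-del-children x y L C u e h = trans (cong (elem y) (sym (del-children-absent x L C u e))) (proj₂ (elem-del-++-false⁻ x y L (labelsF C) h))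

length-substWF : ∀ x L₂ C₂ C → length (substWF x L₂ C₂ C) ≡ length C
length-substWF x L₂ C₂ [] = refl
length-substWF x L₂ C₂ (t ∷ C) = cong suc (length-substWF x L₂ C₂ C)

-- Case (R3) replaces a child by the (non-empty) children of the red root.
length-substRF : ∀ x S C → 1 ≤ length (children S) → length C ≤ length (substRF x S C)
length-substRF x S [] p = z≤n
length-substRF x S (t ∷ C) p with isLeafX x t
... | true = subst (suc (length C) ≤_) (sym (length-++ (children S)))
               (≤-trans (s≤s (length-substRF x S C p)) (+-mono-≤ p ≤-refl))
... | false = s≤s (length-substRF x S C p)

mutual
  isRed-substW : ∀ x L₂ C₂ T → isRed (node L₂ C₂) ≡ false → isRed (substW x L₂ C₂ T) ≡ isRed T
  isRed-substW x L₂ C₂ (node L C) r with elem x L in e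
  ... | true = trans (isRed-false (del x L ++ L₂) (C ++ C₂) λ { (m , w) →
                  true≢false (trans (sym (isRed-node L₂ C₂ (++-conicalʳ (del x L) L₂ m) (∧-trueʳ _ _ (trans (sym (allWhite-++ C C₂)) w)))) r) })
                     (sym (isRed-labelled x L C e))
  ... | false = isRed-substW-node x L₂ C₂ L C r

  isRed-substW-node : ∀ x L₂ C₂ L C → isRed (node L₂ C₂) ≡ false → isRed (node L (substWF x L₂ C₂ C)) ≡ isRed (node L C)
  isRed-substW-node x L₂ C₂ [] C r = allWhite-substWF x L₂ C₂ C r
  isRed-substW-node x L₂ C₂ (_ ∷ _) C r = refl

  allWhite-substWF : ∀ x L₂ C₂ C → isRed (node L₂ C₂) ≡ false → allWhite (substWF x L₂ C₂ C) ≡ allWhite C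
  allWhite-substWF x L₂ C₂ [] r = refl
  allWhite-substWF x L₂ C₂ (t ∷ C) r = cong₂ (λ a b → not a ∧ b) (isRed-substW x L₂ C₂ t r) (allWhite-substWF x L₂ C₂ C r)

mutual
  isRed-substR : ∀ x S T → isRed S ≡ true → isRed (substR x S T) ≡ isRed T
  isRed-substR x S (node L C) r with elem x L in e
  ... | true = trans (isRed-false (del x L) (C ++ (S ∷ [])) λ { (m , w) →
                  true≢false (trans (sym (∧-trueʳ (allWhite C) _ (trans (sym (allWhite-++ C (S ∷ []))) w)))
                        (cong (λ b → not b ∧ true) r)) })
                     (sym (isRed-labelled x L C e))
  ... | false = isRed-substR-node x S L C r

  isRed-substR-node : ∀ x S L C → isRed S ≡ true → isRed (node L (substRF x S C)) ≡ isRed (node L C)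
  isRed-substR-node x S [] C r = allWhite-substRF x S C r
  isRed-substR-node x S (_ ∷ _) C r = refl

  allWhite-substRF : ∀ x S C → isRed S ≡ true → allWhite (substRF x S C) ≡ allWhite C
  allWhite-substRF x S [] r = refl
  allWhite-substRF x S (t ∷ C) r with isLeafX x t in l
  ... | true = trans (allWhite-++ (children S) _) (trans (cong (_∧ allWhite (substRF x S C)) (red⇒children-white S r))
                 (trans (allWhite-substRF x S C r) (cong (λ b → not b ∧ allWhite C) (sym (isLeafX⇒white x t l)))))
  ... | false = cong₂ (λ a b → not a ∧ b) (isRed-substR x S t r) (allWhite-substRF x S C r)

isRed-graft : ∀ x S T → (isRed S ≡ true → isLeafX x T ≡ false) → isRed (graft x S T) ≡ isRed T
isRed-graft x S@(node L₂ C₂) T h with isRed (node L₂ C₂) in r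
... | false = isRed-substW x L₂ C₂ T r
... | true rewrite h refl = isRed-substR x S T r

mutual
  substW-absent : ∀ x L₂ C₂ T → elem x (labels T) ≡ false → substW x L₂ C₂ T ≡ T
  substW-absent x L₂ C₂ (node L C) e rewrite proj₁ (elem-++-false⁻ x L (labelsF C) e) =
    cong (node L) (substWF-absent x L₂ C₂ C (proj₂ (elem-++-false⁻ x L (labelsF C) e)))

  substWF-absent : ∀ x L₂ C₂ C → elem x (labelsF C) ≡ false → substWF x L₂ C₂ C ≡ C
  substWF-absent x L₂ C₂ [] e = refl
  substWF-absent x L₂ C₂ (t ∷ C) e = cong₂ _∷_ (substW-absent x L₂ C₂ t (proj₁ (elem-++-false⁻ x (labels t) (labelsF C) e)))
                                               (substWF-absent x L₂ C₂ C (proj₂ (elem-++-false⁻ x (labels t) (labelsF C) e)))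

mutual
  substR-absent : ∀ x S T → elem x (labels T) ≡ false → substR x S T ≡ T
  substR-absent x S (node L C) e rewrite proj₁ (elem-++-false⁻ x L (labelsF C) e) =
    cong (node L) (substRF-absent x S C (proj₂ (elem-++-false⁻ x L (labelsF C) e)))

  substRF-absent : ∀ x S C → elem x (labelsF C) ≡ false → substRF x S C ≡ C
  substRF-absent x S [] e = refl
  substRF-absent x S (t ∷ C) e rewrite isLeafX-absent x t (proj₁ (elem-++-false⁻ x (labels t) (labelsF C) e)) =
    cong₂ _∷_ (substR-absent x S t (proj₁ (elem-++-false⁻ x (labels t) (labelsF C) e)))
              (substRF-absent x S C (proj₂ (elem-++-false⁻ x (labels t) (labelsF C) e)))

mutual
  labels-substW : ∀ x L₂ C₂ T → Distinct (labels T) → elem x (labels T) ≡ true →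
            labels (substW x L₂ C₂ T) ↭ del x (labels T) ++ (L₂ ++ labelsF C₂)
  labels-substW x L₂ C₂ (node L C) u h with elem x L in e
  ... | true = ↭-trans (↭-reflexive (cong ((del x L ++ L₂) ++_) (labelsF-++ C C₂)))
               (↭-trans (↭-middle-swap (del x L) L₂ (labelsF C) (labelsF C₂))
                (↭-reflexive (cong (_++ (L₂ ++ labelsF C₂)) (sym (trans (del-++ x L (labelsF C))
                   (cong (del x L ++_) (del-notin x (labelsF C) (Distinct-disjoint x L (labelsF C) u e))))))))
  ... | false = ↭-trans (PPP.++⁺ˡ L (labels-substWF x L₂ C₂ C (Distinct-++ʳ L _ u) (elem-++-true-right x L (labelsF C) h e)))
                (↭-reflexive (trans (sym (++-assoc L (del x (labelsF C)) _))
                  (cong (_++ (L₂ ++ labelsF C₂)) (sym (trans (del-++ x L (labelsF C)) (cong (_++ del x (labelsF C)) (del-notin x L e)))))))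

  labels-substWF : ∀ x L₂ C₂ C → Distinct (labelsF C) → elem x (labelsF C) ≡ true →
            labelsF (substWF x L₂ C₂ C) ↭ del x (labelsF C) ++ (L₂ ++ labelsF C₂)
  labels-substWF x L₂ C₂ [] u ()
  labels-substWF x L₂ C₂ (t ∷ C) u h with elem x (labels t) in e
  ... | true = let nC = Distinct-disjoint x (labels t) (labelsF C) u e in
               ↭-trans (↭-reflexive (cong (labels (substW x L₂ C₂ t) ++_) (cong labelsF (substWF-absent x L₂ C₂ C nC))))
               (↭-trans (PPP.++⁺ʳ (labelsF C) (labels-substW x L₂ C₂ t (Distinct-++ˡ (labels t) _ u) e))
               (↭-trans (↭-swap-last (del x (labels t)) _ (labelsF C))
                 (↭-reflexive (cong (_++ (L₂ ++ labelsF C₂)) (sym (trans (del-++ x (labels t) (labelsF C))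
                     (cong (del x (labels t) ++_) (del-notin x (labelsF C) nC))))))))
  ... | false = ↭-trans (↭-reflexive (cong (_++ labelsF (substWF x L₂ C₂ C)) (cong labels (substW-absent x L₂ C₂ t e))))
                (↭-trans (PPP.++⁺ˡ (labels t) (labels-substWF x L₂ C₂ C (Distinct-++ʳ (labels t) _ u) (elem-++-true-right x (labels t) (labelsF C) h e)))
                (↭-reflexive (trans (sym (++-assoc (labels t) (del x (labelsF C)) _))
                  (cong (_++ (L₂ ++ labelsF C₂)) (sym (trans (del-++ x (labels t) (labelsF C)) (cong (_++ del x (labelsF C)) (del-notin x (labels t) e))))))))

mutual
  labels-substR : ∀ x S T → isRed S ≡ true → Distinct (labels T) → elem x (labels T) ≡ true →
            labels (substR x S T) ↭ del x (labels T) ++ labels S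
  labels-substR x S (node L C) r u h with elem x L in e
  ... | true = ↭-reflexive (trans (cong (del x L ++_) (trans (labelsF-++ C (S ∷ [])) (cong (labelsF C ++_) (++-identityʳ (labels S)))))
                 (trans (sym (++-assoc (del x L) (labelsF C) (labels S)))
                  (cong (_++ labels S) (sym (trans (del-++ x L (labelsF C))
                   (cong (del x L ++_) (del-notin x (labelsF C) (Distinct-disjoint x L (labelsF C) u e))))))))
  ... | false = ↭-trans (PPP.++⁺ˡ L (labels-substRF x S C r (Distinct-++ʳ L _ u) (elem-++-true-right x L (labelsF C) h e)))
                (↭-reflexive (trans (sym (++-assoc L (del x (labelsF C)) _))
                  (cong (_++ labels S) (sym (trans (del-++ x L (labelsF C)) (cong (_++ del x (labelsF C)) (del-notin x L e)))))))

  labels-substRF : ∀ x S C → isRed S ≡ true → Distinct (labelsF C) → elem x (labelsF C) ≡ true →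
            labelsF (substRF x S C) ↭ del x (labelsF C) ++ labels S
  labels-substRF x S [] r u ()
  labels-substRF x S (t ∷ C) r u h with elem x (labels t) in e
  ... | true with isLeafX x t in l
  ...   | true = let nC = Distinct-disjoint x (labels t) (labelsF C) u e in
               ↭-trans (↭-reflexive (trans (labelsF-++ (children S) _) (cong (labelsF (children S) ++_) (cong labelsF (substRF-absent x S C nC)))))
               (↭-trans (PPP.++-comm (labelsF (children S)) (labelsF C))
               (↭-reflexive (sym (trans (cong₂ _++_ (trans (del-++ x (labels t) (labelsF C))
                   (cong₂ _++_ (isLeafX-del x t l) (del-notin x (labelsF C) nC))) (labels-red S r)) refl))))
  ...   | false = let nC = Distinct-disjoint x (labels t) (labelsF C) u e in
               ↭-trans (↭-reflexive (cong (labels (substR x S t) ++_) (cong labelsF (substRF-absent x S C nC))))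
               (↭-trans (PPP.++⁺ʳ (labelsF C) (labels-substR x S t r (Distinct-++ˡ (labels t) _ u) e))
               (↭-trans (↭-swap-last (del x (labels t)) _ (labelsF C))
                 (↭-reflexive (cong (_++ labels S) (sym (trans (del-++ x (labels t) (labelsF C))
                     (cong (del x (labels t) ++_) (del-notin x (labelsF C) nC))))))))
  labels-substRF x S (t ∷ C) r u h | false rewrite isLeafX-absent x t e =
                ↭-trans (↭-reflexive (cong (_++ labelsF (substRF x S C)) (cong labels (substR-absent x S t e))))
                (↭-trans (PPP.++⁺ˡ (labels t) (labels-substRF x S C r (Distinct-++ʳ (labels t) _ u) (elem-++-true-right x (labels t) (labelsF C) h e)))
                (↭-reflexive (trans (sym (++-assoc (labels t) (del x (labelsF C)) _))
                  (cong (_++ labels S) (sym (trans (del-++ x (labels t) (labelsF C)) (cong (_++ del x (labelsF C)) (del-notin x (labels t) e))))))))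

labels-graft : ∀ x S T → Distinct (labels T) → elem x (labels T) ≡ true → labels (graft x S T) ↭ del x (labels T) ++ labels S
labels-graft x S@(node L₂ C₂) T u h with isRed (node L₂ C₂) in r
... | false = labels-substW x L₂ C₂ T u h
... | true with isLeafX x T in l
... | true = ↭-reflexive (cong (_++ labels S) (sym (isLeafX-del x T l)))
... | false = labels-substR x S T r u h

mutual
  branching-substW : ∀ x L₂ C₂ T → Branching (node L₂ C₂) → Branching T → Branching (substW x L₂ C₂ T)
  branching-substW x L₂ C₂ (node L C) b₂@(branching h₂ a₂) (branching h a) with elem x L
  ... | true = branching (λ m → ≤-trans (h₂ (++-conicalʳ (del x L) L₂ m))
                   (subst (length C₂ ≤_) (sym (length-++ C)) (m≤n+m (length C₂) (length C))))
                 (++⁺ a a₂)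
  ... | false = branching (λ m → subst (2 ≤_) (sym (length-substWF x L₂ C₂ C)) (h m)) (branching-substWF x L₂ C₂ C b₂ a)

  branching-substWF : ∀ x L₂ C₂ C → Branching (node L₂ C₂) → All Branching C → All Branching (substWF x L₂ C₂ C)
  branching-substWF x L₂ C₂ [] b₂ [] = []
  branching-substWF x L₂ C₂ (t ∷ C) b₂ (b ∷ a) = branching-substW x L₂ C₂ t b₂ b ∷ branching-substWF x L₂ C₂ C b₂ a

-- Grafting a red root preserves the branching condition: if (R2) leaves the
-- node z without labels then z is not the leaf {x}, so it has an old child
-- besides the grafted one.
mutual
  branching-substR : ∀ x S T → Branching S → isRed S ≡ true → Distinct (labels T) → isLeafX x T ≡ false → Branching T → Branching (substR x S T)
  branching-substR x S (node L C) bS r u l (branching h a) with elem x L in e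
  branching-substR x S (node L []) bS r u l (branching h a) | true =
     branching (λ m → ⊥-elim (true≢false (trans (sym (trans (cong (λ M → isLeafX x (node M [])) (del≡[] x L (Distinct-++ˡ L [] u) e m)) (isLeafX-self x))) l))) (bS ∷ [])
  branching-substR x S (node L (c ∷ C)) bS r u l (branching h a) | true =
     branching (λ m → s≤s (subst (1 ≤_) (sym (length-++ C)) (m≤n+m 1 (length C)))) (++⁺ a (bS ∷ []))
  ... | false = branching (λ m → ≤-trans (h m) (length-substRF x S C (≤-trans (s≤s z≤n) (red-branching S bS r))))
                          (branching-substRF x S C bS r (Distinct-++ʳ L _ u) a)

  branching-substRF : ∀ x S C → Branching S → isRed S ≡ true → Distinct (labelsF C) → All Branching C → All Branching (substRF x S C)
  branching-substRF x S [] bS r u [] = []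
  branching-substRF x S (t ∷ C) bS r u (b ∷ a) with isLeafX x t in l
  ... | true = ++⁺ (branching-children S bS) (branching-substRF x S C bS r (Distinct-++ʳ (labels t) _ u) a)
  ... | false = branching-substR x S t bS r (Distinct-++ˡ (labels t) _ u) l b ∷ branching-substRF x S C bS r (Distinct-++ʳ (labels t) _ u) a

branching-graft : ∀ x S T → Branching S → Distinct (labels T) → Branching T → Branching (graft x S T)
branching-graft x S@(node L₂ C₂) T bS u bT with isRed (node L₂ C₂) in r
... | false = branching-substW x L₂ C₂ T bS bT
... | true with isLeafX x T in l
... | true = bS
... | false = branching-substR x S T bS r u l bT

mutual
  substW-congT : ∀ x L₂ C₂ {s t} → s ≅ t → substW x L₂ C₂ s ≅ substW x L₂ C₂ t
  substW-congT x L₂ C₂ {node L C} {node L′ C′} (node≅ p q) rewrite elem-cong x p with elem x L′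
  ... | true = node≅ (PPP.++⁺ʳ L₂ (del-cong x p)) (TreePerm.++⁺ʳ C₂ q)
  ... | false = node≅ p (substWF-cong x L₂ C₂ q)

  substWF-cong : ∀ x L₂ C₂ {C D} → C ~ D → substWF x L₂ C₂ C ~ substWF x L₂ C₂ D
  substWF-cong x L₂ C₂ (H.refl pw) = H.refl (substWF-pw x L₂ C₂ pw)
  substWF-cong x L₂ C₂ (H.prep e q) = H.prep (substW-congT x L₂ C₂ e) (substWF-cong x L₂ C₂ q)
  substWF-cong x L₂ C₂ (H.swap e₁ e₂ q) = H.swap (substW-congT x L₂ C₂ e₁) (substW-congT x L₂ C₂ e₂) (substWF-cong x L₂ C₂ q)
  substWF-cong x L₂ C₂ (H.trans p q) = H.trans (substWF-cong x L₂ C₂ p) (substWF-cong x L₂ C₂ q)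

  substWF-pw : ∀ x L₂ C₂ {C D} → Pointwise _≅_ C D → Pointwise _≅_ (substWF x L₂ C₂ C) (substWF x L₂ C₂ D)
  substWF-pw x L₂ C₂ [] = []
  substWF-pw x L₂ C₂ (e ∷ pw) = substW-congT x L₂ C₂ e ∷ substWF-pw x L₂ C₂ pw

mutual
  substW-congS : ∀ x {L₂ L₂′ C₂ C₂′} → L₂ ↭ L₂′ → C₂ ~ C₂′ → ∀ t → substW x L₂ C₂ t ≅ substW x L₂′ C₂′ t
  substW-congS x p₂ q₂ (node L C) with elem x L
  ... | true = node≅ (PPP.++⁺ˡ (del x L) p₂) (TreePerm.++⁺ˡ C q₂)
  ... | false = node≅ ↭-refl (H.refl (substWF-congS x p₂ q₂ C))

  substWF-congS : ∀ x {L₂ L₂′ C₂ C₂′} → L₂ ↭ L₂′ → C₂ ~ C₂′ → ∀ C → Pointwise _≅_ (substWF x L₂ C₂ C) (substWF x L₂′ C₂′ C)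
  substWF-congS x p₂ q₂ [] = []
  substWF-congS x p₂ q₂ (t ∷ C) = substW-congS x p₂ q₂ t ∷ substWF-congS x p₂ q₂ C

substRF-block : ℕ → Tree → Tree → List Tree
substRF-block x S t = if isLeafX x t then children S else (substR x S t ∷ [])

substRF-∷ : ∀ x S t C → substRF x S (t ∷ C) ≡ substRF-block x S t ++ substRF x S C
substRF-∷ x S t C with isLeafX x t
... | true = refl
... | false = refl

mutual
  substR-congT : ∀ x S {s t} → s ≅ t → substR x S s ≅ substR x S t
  substR-congT x S {node L C} {node L′ C′} (node≅ p q) rewrite elem-cong x p with elem x L′
  ... | true = node≅ (del-cong x p) (TreePerm.++⁺ʳ (S ∷ []) q)
  ... | false = node≅ p (substRF-cong x S q)

  substRF-block-cong : ∀ x S {s t} → s ≅ t → substRF-block x S s ~ substRF-block x S t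
  substRF-block-cong x S {s} {t} e rewrite isLeafX-cong x e with isLeafX x t
  ... | true = ~-refl
  ... | false = H.prep (substR-congT x S e) ~-refl

  substRF-cong : ∀ x S {C D} → C ~ D → substRF x S C ~ substRF x S D
  substRF-cong x S (H.refl pw) = substRF-pw x S pw
  substRF-cong x S (H.prep {xs = xs} {ys = ys} {x = a} {y = b} e q) =
    ~-subst₂ (substRF-∷ x S a xs) (substRF-∷ x S b ys) (TreePerm.++⁺ (substRF-block-cong x S e) (substRF-cong x S q))
  substRF-cong x S (H.swap {xs = xs} {ys = ys} {x = a} {y = b} {x′ = a′} {y′ = b′} e₁ e₂ q) =
    ~-subst₂ (trans (substRF-∷ x S a (b ∷ xs)) (cong (substRF-block x S a ++_) (substRF-∷ x S b xs)))
            (trans (substRF-∷ x S b′ (a′ ∷ ys)) (cong (substRF-block x S b′ ++_) (substRF-∷ x S a′ ys)))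
            (H.trans (TreePerm.++⁺ (substRF-block-cong x S e₁) (TreePerm.++⁺ (substRF-block-cong x S e₂) (substRF-cong x S q)))
                     (TreePerm.shifts (substRF-block x S a′) (substRF-block x S b′)))
  substRF-cong x S (H.trans p q) = H.trans (substRF-cong x S p) (substRF-cong x S q)

  substRF-pw : ∀ x S {C D} → Pointwise _≅_ C D → substRF x S C ~ substRF x S D
  substRF-pw x S [] = ~-refl
  substRF-pw x S (_∷_ {x = a} {y = b} {xs = xs} {ys = ys} e pw) =
    ~-subst₂ (substRF-∷ x S a xs) (substRF-∷ x S b ys) (TreePerm.++⁺ (substRF-block-cong x S e) (substRF-pw x S pw))

mutual
  substR-congS : ∀ x {S S′} → S ≅ S′ → ∀ t → substR x S t ≅ substR x S′ t
  substR-congS x e (node L C) with elem x L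
  ... | true = node≅ ↭-refl (TreePerm.++⁺ˡ C (H.prep e ~-refl))
  ... | false = node≅ ↭-refl (substRF-congS x e C)

  substRF-congS : ∀ x {S S′} → S ≅ S′ → ∀ C → substRF x S C ~ substRF x S′ C
  substRF-congS x e [] = ~-refl
  substRF-congS x e (t ∷ C) with isLeafX x t
  ... | true = TreePerm.++⁺ (children-≅ e) (substRF-congS x e C)
  ... | false = H.prep (substR-congS x e t) (substRF-congS x e C)

graft-cong : ∀ x {S S′ T T′} → S ≅ S′ → T ≅ T′ → graft x S T ≅ graft x S′ T′
graft-cong x {S} {S′} {T} {T′} eS eT rewrite isRed-cong eS with isRed S′
... | false = ≅-trans (substW-congS x (rootLabels-≅ eS) (children-≅ eS) T) (substW-congT x _ _ eT)
... | true rewrite isLeafX-cong x eT with isLeafX x T′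
... | true = eS
... | false = ≅-trans (substR-congS x eS T) (substR-congT x S′ eT)

Compatible : (ℕ → ℕ) → (ℕ → ℕ) → ℕ → ℕ → Set
Compatible f g x y = (y ≢ x → f y ≡ g y) × (g y ≡ g x → y ≡ x)

injective-compatible : ∀ (f : ℕ → ℕ) → (∀ a b → f a ≡ f b → a ≡ b) → ∀ p L → All (Compatible f f p) L
injective-compatible f inj p [] = []
injective-compatible f inj p (z ∷ L) = ((λ _ → refl) , inj z p) ∷ injective-compatible f inj p L

does-≟-map : ∀ g x y → (g y ≡ g x → y ≡ x) → does (g y ≟ g x) ≡ does (y ≟ x)
does-≟-map g x y h with y ≟ x
... | yes p = trans (≡ᵇ-true (cong g p)) (sym (≡ᵇ-true p))
... | no p with g y ≟ g x
... | yes q = ⊥-elim (p (h q))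
... | no q = trans (≡ᵇ-false q) (sym (≡ᵇ-false p))

elem-map-compatible : ∀ f g x L → All (Compatible f g x) L → elem (g x) (map g L) ≡ elem x L
elem-map-compatible f g x [] a = refl
elem-map-compatible f g x (y ∷ L) ((_ , h) ∷ a) = cong₂ _∨_ (does-≟-map g x y h) (elem-map-compatible f g x L a)

del-map-compatible : ∀ f g x L → All (Compatible f g x) L → map f (del x L) ≡ del (g x) (map g L)
del-map-compatible f g x [] a = refl
del-map-compatible f g x (y ∷ L) ((h₁ , h₂) ∷ a) rewrite does-≟-map g x y h₂ with y ≡ᵇ x | ≡ᵇ-view y x
... | true | _ = del-map-compatible f g x L a
... | false | unequal p = cong₂ _∷_ (h₁ p) (del-map-compatible f g x L a)

map-compatible-absent : ∀ f g x L → All (Compatible f g x) L → elem x L ≡ false → map f L ≡ map g L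
map-compatible-absent f g x [] a e = refl
map-compatible-absent f g x (y ∷ L) ((h₁ , h₂) ∷ a) e with y ≡ᵇ x | ≡ᵇ-view y x
... | true | _ = ⊥-elim (true≢false e)
... | false | unequal p = cong₂ _∷_ (h₁ p) (map-compatible-absent f g x L a e)

mutual
  relabel-compatible-absent : ∀ f g x T → All (Compatible f g x) (labels T) → elem x (labels T) ≡ false → relabel f T ≡ relabel g T
  relabel-compatible-absent f g x (node L C) a e =
    let e′ = ∨-false⁻ _ _ (trans (sym (elem-++ x L (labelsF C))) e) in
    cong₂ node (map-compatible-absent f g x L (++⁻ˡ L a) (proj₁ e′)) (relabelF-compatible-absent f g x C (++⁻ʳ L a) (proj₂ e′))

  relabelF-compatible-absent : ∀ f g x C → All (Compatible f g x) (labelsF C) → elem x (labelsF C) ≡ false → relabelF f C ≡ relabelF g C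
  relabelF-compatible-absent f g x [] a e = refl
  relabelF-compatible-absent f g x (t ∷ C) a e =
    let e′ = ∨-false⁻ _ _ (trans (sym (elem-++ x (labels t) (labelsF C))) e) in
    cong₂ _∷_ (relabel-compatible-absent f g x t (++⁻ˡ (labels t) a) (proj₁ e′)) (relabelF-compatible-absent f g x C (++⁻ʳ (labels t) a) (proj₂ e′))

isLeafX-relabel : ∀ f g x T → All (Compatible f g x) (labels T) → isLeafX (g x) (relabel g T) ≡ isLeafX x T
isLeafX-relabel f g x (node [] C) a = refl
isLeafX-relabel f g x (node (y ∷ []) []) ((_ , h) ∷ a) = does-≟-map g x y h
isLeafX-relabel f g x (node (y ∷ []) (_ ∷ _)) a = refl
isLeafX-relabel f g x (node (y ∷ _ ∷ _) C) a = refl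

mutual
  relabel-substW : ∀ f g x L₂ C₂ T → Distinct (labels T) → All (Compatible f g x) (labels T) →
         relabel f (substW x L₂ C₂ T) ≡ substW (g x) (map f L₂) (relabelF f C₂) (relabel g T)
  relabel-substW f g x L₂ C₂ (node L C) u a rewrite elem-map-compatible f g x L (++⁻ˡ L a) with elem x L in e
  ... | true = cong₂ node (trans (map-++ f (del x L) L₂) (cong (_++ map f L₂) (del-map-compatible f g x L (++⁻ˡ L a))))
                          (trans (relabelF-++ f C C₂) (cong (_++ relabelF f C₂)
                            (relabelF-compatible-absent f g x C (++⁻ʳ L a) (Distinct-disjoint x L (labelsF C) u e))))
  ... | false = cong₂ node (map-compatible-absent f g x L (++⁻ˡ L a) e) (relabel-substWF f g x L₂ C₂ C (Distinct-++ʳ L _ u) (++⁻ʳ L a))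

  relabel-substWF : ∀ f g x L₂ C₂ C → Distinct (labelsF C) → All (Compatible f g x) (labelsF C) →
         relabelF f (substWF x L₂ C₂ C) ≡ substWF (g x) (map f L₂) (relabelF f C₂) (relabelF g C)
  relabel-substWF f g x L₂ C₂ [] u a = refl
  relabel-substWF f g x L₂ C₂ (t ∷ C) u a = cong₂ _∷_ (relabel-substW f g x L₂ C₂ t (Distinct-++ˡ (labels t) _ u) (++⁻ˡ (labels t) a))
                                              (relabel-substWF f g x L₂ C₂ C (Distinct-++ʳ (labels t) _ u) (++⁻ʳ (labels t) a))

mutual
  relabel-substR : ∀ f g x S T → Distinct (labels T) → All (Compatible f g x) (labels T) →
         relabel f (substR x S T) ≡ substR (g x) (relabel f S) (relabel g T)
  relabel-substR f g x S (node L C) u a rewrite elem-map-compatible f g x L (++⁻ˡ L a) with elem x L in e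
  ... | true = cong₂ node (del-map-compatible f g x L (++⁻ˡ L a))
                          (trans (relabelF-++ f C (S ∷ [])) (cong (_++ (relabel f S ∷ []))
                            (relabelF-compatible-absent f g x C (++⁻ʳ L a) (Distinct-disjoint x L (labelsF C) u e))))
  ... | false = cong₂ node (map-compatible-absent f g x L (++⁻ˡ L a) e) (relabel-substRF f g x S C (Distinct-++ʳ L _ u) (++⁻ʳ L a))

  relabel-substRF : ∀ f g x S C → Distinct (labelsF C) → All (Compatible f g x) (labelsF C) →
         relabelF f (substRF x S C) ≡ substRF (g x) (relabel f S) (relabelF g C)
  relabel-substRF f g x S [] u a = refl
  relabel-substRF f g x S (t ∷ C) u a rewrite isLeafX-relabel f g x t (++⁻ˡ (labels t) a) with isLeafX x t
  ... | true = trans (relabelF-++ f (children S) _) (cong₂ _++_ (childrenRel S) (relabel-substRF f g x S C (Distinct-++ʳ (labels t) _ u) (++⁻ʳ (labels t) a)))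
    where childrenRel : ∀ S → relabelF f (children S) ≡ children (relabel f S)
          childrenRel (node _ _) = refl
  ... | false = cong₂ _∷_ (relabel-substR f g x S t (Distinct-++ˡ (labels t) _ u) (++⁻ˡ (labels t) a))
                          (relabel-substRF f g x S C (Distinct-++ʳ (labels t) _ u) (++⁻ʳ (labels t) a))

relabel-graft : ∀ f g x S T → Distinct (labels T) → All (Compatible f g x) (labels T) →
      relabel f (graft x S T) ≡ graft (g x) (relabel f S) (relabel g T)
relabel-graft f g x S@(node L₂ C₂) T u a rewrite isRed-relabel f S | isLeafX-relabel f g x T a with isRed S
... | false = relabel-substW f g x L₂ C₂ T u a
... | true with isLeafX x T
... | true = refl
... | false = relabel-substR f g x S T u a

isLeafX-substW-absent : ∀ x y L₂ C₂ T → Distinct (labels T) → elem y (del x (labels T)) ≡ false → isLeafX y (node L₂ C₂) ≡ false →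
        isLeafX y (substW x L₂ C₂ T) ≡ false
isLeafX-substW-absent x y L₂ C₂ (node L C) u h l with elem x L in e
... | true = isLeafX-merge y (del x L) L₂ C C₂ (proj₁ (elem-del-++-false⁻ x y L (labelsF C) h)) l
... | false = isLeafX-unlabelled y L _ (elem-del-absent x y L e (proj₁ (elem-del-++-false⁻ x y L (labelsF C) h)))

isLeafX-substR-absent : ∀ x y S T → elem y (del x (labels T)) ≡ false → isLeafX y (substR x S T) ≡ false
isLeafX-substR-absent x y S (node L C) h with elem x L in e
... | true = isLeafX-snoc y (del x L) C S
... | false = isLeafX-unlabelled y L _ (elem-del-absent x y L e (proj₁ (elem-del-++-false⁻ x y L (labelsF C) h)))

isLeafX-rename : ∀ x y T → Distinct (labels T) → elem y (del x (labels T)) ≡ false →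
          isLeafX y (substW x (y ∷ []) [] T) ≡ isLeafX x T
isLeafX-rename x y (node L C) u h with elem x L in e
isLeafX-rename x y (node L (c ∷ C)) u h | true = trans (isLeafX-inner y (del x L ++ y ∷ []) c (C ++ [])) (sym (isLeafX-inner x L c C))
isLeafX-rename x y (node L []) u h | true with del x L in d | isLeafX x (node L []) in l
... | [] | true = ≡ᵇ-true {y} {y} refl
... | [] | false = ⊥-elim (true≢false (trans (sym (trans (cong (λ M → isLeafX x (node M [])) (del≡[] x L (Distinct-++ˡ L [] u) e d)) (≡ᵇ-true {x} {x} refl))) l))
... | a ∷ r | true = ⊥-elim (nil≢cons (trans (sym (isLeafX-leaf-del x L l)) d))
  where nil≢cons : ∀ {a : ℕ} {r : List ℕ} → [] ≡ a ∷ r → ⊥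
        nil≢cons ()
... | a ∷ [] | false = refl
... | a ∷ _ ∷ _ | false = refl
isLeafX-rename x y (node L C) u h | false =
  trans (isLeafX-unlabelled y L _ (elem-del-absent x y L e (proj₁ (elem-del-++-false⁻ x y L (labelsF C) h)))) (sym (isLeafX-unlabelled x L C e))

mutual
  substW-substW : ∀ x y L₂ C₂ L₃ C₃ T → Distinct (labels T) → elem y (del x (labels T)) ≡ false →
       substW y L₃ C₃ (substW x L₂ C₂ T)
         ≡ substW x (rootLabels (substW y L₃ C₃ (node L₂ C₂))) (children (substW y L₃ C₃ (node L₂ C₂))) T
  substW-substW x y L₂ C₂ L₃ C₃ (node L C) u h with elem x L in e
  ... | true rewrite elem-++ y (del x L) L₂ | proj₁ (elem-del-++-false⁻ x y L (labelsF C) h) with elem y L₂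
  ...   | true = cong₂ node (trans (cong (_++ L₃) (trans (del-++ y (del x L) L₂) (cong (_++ del y L₂) (del-notin y (del x L) (proj₁ (elem-del-++-false⁻ x y L (labelsF C) h))))))
                                  (++-assoc (del x L) (del y L₂) L₃))
                            (++-assoc C C₂ C₃)
  ...   | false = cong (node (del x L ++ L₂)) (trans (substWF-++ y L₃ C₃ C C₂)
                     (cong (_++ substWF y L₃ C₃ C₂) (substWF-absent y L₃ C₃ C (elem-del-children x y L C u e h))))
  substW-substW x y L₂ C₂ L₃ C₃ (node L C) u h | false rewrite elem-del-absent x y L e (proj₁ (elem-del-++-false⁻ x y L (labelsF C) h)) =
    cong (node L) (substWF-substWF x y L₂ C₂ L₃ C₃ C (Distinct-++ʳ L _ u) (proj₂ (elem-del-++-false⁻ x y L (labelsF C) h)))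

  substWF-substWF : ∀ x y L₂ C₂ L₃ C₃ C → Distinct (labelsF C) → elem y (del x (labelsF C)) ≡ false →
       substWF y L₃ C₃ (substWF x L₂ C₂ C)
         ≡ substWF x (rootLabels (substW y L₃ C₃ (node L₂ C₂))) (children (substW y L₃ C₃ (node L₂ C₂))) C
  substWF-substWF x y L₂ C₂ L₃ C₃ [] u h = refl
  substWF-substWF x y L₂ C₂ L₃ C₃ (t ∷ C) u h =
    cong₂ _∷_ (substW-substW x y L₂ C₂ L₃ C₃ t (Distinct-++ˡ (labels t) _ u) (proj₁ (elem-del-++-false⁻ x y (labels t) (labelsF C) h)))
              (substWF-substWF x y L₂ C₂ L₃ C₃ C (Distinct-++ʳ (labels t) _ u) (proj₂ (elem-del-++-false⁻ x y (labels t) (labelsF C) h)))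

mutual
  substR-substW : ∀ x y L₂ C₂ S₃ T → Distinct (labels T) → elem y (del x (labels T)) ≡ false → isLeafX y (node L₂ C₂) ≡ false →
       substR y S₃ (substW x L₂ C₂ T)
         ≡ substW x (rootLabels (substR y S₃ (node L₂ C₂))) (children (substR y S₃ (node L₂ C₂))) T
  substR-substW x y L₂ C₂ S₃ (node L C) u h l with elem x L in e
  ... | true rewrite elem-++ y (del x L) L₂ | proj₁ (elem-del-++-false⁻ x y L (labelsF C) h) with elem y L₂
  ...   | true = cong₂ node (trans (del-++ y (del x L) L₂) (cong (_++ del y L₂) (del-notin y (del x L) (proj₁ (elem-del-++-false⁻ x y L (labelsF C) h)))))
                            (++-assoc C C₂ (S₃ ∷ []))
  ...   | false = cong (node (del x L ++ L₂)) (trans (substRF-++ y S₃ C C₂)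
                     (cong (_++ substRF y S₃ C₂) (substRF-absent y S₃ C (elem-del-children x y L C u e h))))
  substR-substW x y L₂ C₂ S₃ (node L C) u h l | false rewrite elem-del-absent x y L e (proj₁ (elem-del-++-false⁻ x y L (labelsF C) h)) =
    cong (node L) (substRF-substWF x y L₂ C₂ S₃ C (Distinct-++ʳ L _ u) (proj₂ (elem-del-++-false⁻ x y L (labelsF C) h)) l)

  substRF-substWF : ∀ x y L₂ C₂ S₃ C → Distinct (labelsF C) → elem y (del x (labelsF C)) ≡ false → isLeafX y (node L₂ C₂) ≡ false →
       substRF y S₃ (substWF x L₂ C₂ C)
         ≡ substWF x (rootLabels (substR y S₃ (node L₂ C₂))) (children (substR y S₃ (node L₂ C₂))) C
  substRF-substWF x y L₂ C₂ S₃ [] u h l = refl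
  substRF-substWF x y L₂ C₂ S₃ (t ∷ C) u h l
    rewrite isLeafX-substW-absent x y L₂ C₂ t (Distinct-++ˡ (labels t) _ u) (proj₁ (elem-del-++-false⁻ x y (labels t) (labelsF C) h)) l =
    cong₂ _∷_ (substR-substW x y L₂ C₂ S₃ t (Distinct-++ˡ (labels t) _ u) (proj₁ (elem-del-++-false⁻ x y (labels t) (labelsF C) h)) l)
              (substRF-substWF x y L₂ C₂ S₃ C (Distinct-++ʳ (labels t) _ u) (proj₂ (elem-del-++-false⁻ x y (labels t) (labelsF C) h)) l)

-- White S₂ equal to the leaf {y}: grafting S₂ at x only renames x to y.
mutual
  substR-rename : ∀ x y S₃ T → Distinct (labels T) → elem y (del x (labels T)) ≡ false →
        substR y S₃ (substW x (y ∷ []) [] T) ≡ substR x S₃ T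
  substR-rename x y S₃ (node L C) u h with elem x L in e
  ... | true rewrite elem-++ y (del x L) (y ∷ []) | proj₁ (elem-del-++-false⁻ x y L (labelsF C) h) | ≡ᵇ-true {y} {y} refl =
    cong₂ node (trans (del-++ y (del x L) (y ∷ [])) (trans (cong (_++ del y (y ∷ [])) (del-notin y (del x L) (proj₁ (elem-del-++-false⁻ x y L (labelsF C) h))))
                  (trans (cong (del x L ++_) (delyy y)) (++-identityʳ (del x L)))))
               (cong (_++ (S₃ ∷ [])) (++-identityʳ C))
    where delyy : ∀ y → del y (y ∷ []) ≡ []
          delyy y rewrite ≡ᵇ-true {y} {y} refl = refl
  ... | false rewrite elem-del-absent x y L e (proj₁ (elem-del-++-false⁻ x y L (labelsF C) h)) =
    cong (node L) (substRF-rename x y S₃ C (Distinct-++ʳ L _ u) (proj₂ (elem-del-++-false⁻ x y L (labelsF C) h)))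

  substRF-rename : ∀ x y S₃ C → Distinct (labelsF C) → elem y (del x (labelsF C)) ≡ false →
        substRF y S₃ (substWF x (y ∷ []) [] C) ≡ substRF x S₃ C
  substRF-rename x y S₃ [] u h = refl
  substRF-rename x y S₃ (t ∷ C) u h
    rewrite isLeafX-rename x y t (Distinct-++ˡ (labels t) _ u) (proj₁ (elem-del-++-false⁻ x y (labels t) (labelsF C) h)) with isLeafX x t
  ... | true = cong (children S₃ ++_) (substRF-rename x y S₃ C (Distinct-++ʳ (labels t) _ u) (proj₂ (elem-del-++-false⁻ x y (labels t) (labelsF C) h)))
  ... | false = cong₂ _∷_ (substR-rename x y S₃ t (Distinct-++ˡ (labels t) _ u) (proj₁ (elem-del-++-false⁻ x y (labels t) (labelsF C) h)))
                          (substRF-rename x y S₃ C (Distinct-++ʳ (labels t) _ u) (proj₂ (elem-del-++-false⁻ x y (labels t) (labelsF C) h)))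

mutual
  substW-substR : ∀ x y L₃ C₃ S₂ T → isRed S₂ ≡ true → Distinct (labels T) → elem y (del x (labels T)) ≡ false →
       substW y L₃ C₃ (substR x S₂ T) ≡ substR x (substW y L₃ C₃ S₂) T
  substW-substR x y L₃ C₃ S₂ (node L C) r u h with elem x L in e
  ... | true rewrite proj₁ (elem-del-++-false⁻ x y L (labelsF C) h) =
    cong (node (del x L)) (trans (substWF-++ y L₃ C₃ C (S₂ ∷ []))
       (cong (_++ (substW y L₃ C₃ S₂ ∷ [])) (substWF-absent y L₃ C₃ C (elem-del-children x y L C u e h))))
  ... | false rewrite elem-del-absent x y L e (proj₁ (elem-del-++-false⁻ x y L (labelsF C) h)) =
    cong (node L) (substWF-substRF x y L₃ C₃ S₂ C r (Distinct-++ʳ L _ u) (proj₂ (elem-del-++-false⁻ x y L (labelsF C) h)))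

  substWF-substRF : ∀ x y L₃ C₃ S₂ C → isRed S₂ ≡ true → Distinct (labelsF C) → elem y (del x (labelsF C)) ≡ false →
       substWF y L₃ C₃ (substRF x S₂ C) ≡ substRF x (substW y L₃ C₃ S₂) C
  substWF-substRF x y L₃ C₃ S₂ [] r u h = refl
  substWF-substRF x y L₃ C₃ S₂ (t ∷ C) r u h with isLeafX x t
  ... | true = trans (substWF-++ y L₃ C₃ (children S₂) _)
                 (cong₂ _++_ (sym (children-substW-red y L₃ C₃ S₂ r)) (substWF-substRF x y L₃ C₃ S₂ C r (Distinct-++ʳ (labels t) _ u) (proj₂ (elem-del-++-false⁻ x y (labels t) (labelsF C) h))))
  ... | false = cong₂ _∷_ (substW-substR x y L₃ C₃ S₂ t r (Distinct-++ˡ (labels t) _ u) (proj₁ (elem-del-++-false⁻ x y (labels t) (labelsF C) h)))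
                          (substWF-substRF x y L₃ C₃ S₂ C r (Distinct-++ʳ (labels t) _ u) (proj₂ (elem-del-++-false⁻ x y (labels t) (labelsF C) h)))

mutual
  substR-substR : ∀ x y S₃ S₂ T → isRed S₂ ≡ true → Distinct (labels T) → elem y (del x (labels T)) ≡ false →
       substR y S₃ (substR x S₂ T) ≡ substR x (substR y S₃ S₂) T
  substR-substR x y S₃ S₂ (node L C) r u h with elem x L in e
  ... | true rewrite proj₁ (elem-del-++-false⁻ x y L (labelsF C) h) =
    cong (node (del x L)) (trans (substRF-++ y S₃ C (S₂ ∷ []))
       (cong₂ _++_ (substRF-absent y S₃ C (elem-del-children x y L C u e h)) (lastR S₂ r)))
    where lastR : ∀ S₂ → isRed S₂ ≡ true → substRF y S₃ (S₂ ∷ []) ≡ substR y S₃ S₂ ∷ []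
          lastR S₂ r rewrite isLeafX-red y S₂ r = refl
  ... | false rewrite elem-del-absent x y L e (proj₁ (elem-del-++-false⁻ x y L (labelsF C) h)) =
    cong (node L) (substRF-substRF x y S₃ S₂ C r (Distinct-++ʳ L _ u) (proj₂ (elem-del-++-false⁻ x y L (labelsF C) h)))

  substRF-substRF : ∀ x y S₃ S₂ C → isRed S₂ ≡ true → Distinct (labelsF C) → elem y (del x (labelsF C)) ≡ false →
       substRF y S₃ (substRF x S₂ C) ≡ substRF x (substR y S₃ S₂) C
  substRF-substRF x y S₃ S₂ [] r u h = refl
  substRF-substRF x y S₃ S₂ (t ∷ C) r u h with isLeafX x t
  ... | true = trans (substRF-++ y S₃ (children S₂) _)
                 (cong₂ _++_ (sym (children-substR-red y S₃ S₂ r)) (substRF-substRF x y S₃ S₂ C r (Distinct-++ʳ (labels t) _ u) (proj₂ (elem-del-++-false⁻ x y (labels t) (labelsF C) h))))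
  ... | false rewrite isLeafX-substR-absent x y S₂ t (proj₁ (elem-del-++-false⁻ x y (labels t) (labelsF C) h)) =
                cong₂ _∷_ (substR-substR x y S₃ S₂ t r (Distinct-++ˡ (labels t) _ u) (proj₁ (elem-del-++-false⁻ x y (labels t) (labelsF C) h)))
                          (substRF-substRF x y S₃ S₂ C r (Distinct-++ʳ (labels t) _ u) (proj₂ (elem-del-++-false⁻ x y (labels t) (labelsF C) h)))

graft-sequential-white-white : ∀ x y S₂ S₃ T → isRed S₂ ≡ false → isRed S₃ ≡ false →
  Distinct (labels T) → elem y (del x (labels T)) ≡ false → graft y S₃ (graft x S₂ T) ≡ graft x (graft y S₃ S₂) T
graft-sequential-white-white x y S₂@(node L₂ C₂) S₃@(node L₃ C₃) T r₂ r₃ u h = begin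
    graft y S₃ (graft x S₂ T)
  ≡⟨ trans (cong (graft y S₃) (graft-white x S₂ T r₂)) (graft-white y S₃ (substW x L₂ C₂ T) r₃) ⟩
    substW y L₃ C₃ (substW x L₂ C₂ T)
  ≡⟨ substW-substW x y L₂ C₂ L₃ C₃ T u h ⟩
    substW x (rootLabels (substW y L₃ C₃ S₂)) (children (substW y L₃ C₃ S₂)) T
  ≡⟨ graft-white x (substW y L₃ C₃ S₂) T (trans (isRed-substW y L₃ C₃ S₂ r₃) r₂) ⟨
    graft x (substW y L₃ C₃ S₂) T
  ≡⟨ cong (λ S → graft x S T) (graft-white y S₃ S₂ r₃) ⟨
    graft x (graft y S₃ S₂) T
  ∎
  where open ≡-Reasoning

graft-relabelled-leaf : ∀ x y S₃ T → isRed S₃ ≡ true → Distinct (labels T) → elem y (del x (labels T)) ≡ false →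
  graft y S₃ (substW x (y ∷ []) [] T) ≡ graft x S₃ T
graft-relabelled-leaf x y S₃ T r₃ u h = by-cases (isLeafX x T)
  (λ lx → trans (graft-red-leaf y S₃ (substW x (y ∷ []) [] T) r₃ (trans (isLeafX-rename x y T u h) lx))
                   (sym (graft-red-leaf x S₃ T r₃ lx)))
  (λ lx → trans (graft-red y S₃ (substW x (y ∷ []) [] T) r₃ (trans (isLeafX-rename x y T u h) lx))
                (trans (substR-rename x y S₃ T u h) (sym (graft-red x S₃ T r₃ lx))))

graft-sequential-white-red : ∀ x y S₂ S₃ T → isRed S₂ ≡ false → isRed S₃ ≡ true →
  Distinct (labels T) → elem y (del x (labels T)) ≡ false → graft y S₃ (graft x S₂ T) ≡ graft x (graft y S₃ S₂) T
graft-sequential-white-red x y S₂@(node L₂ C₂) S₃ T r₂ r₃ u h = by-cases (isLeafX y S₂)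
  (λ ly → trans (cong (graft y S₃) (trans (graft-white x S₂ T r₂)
                                  (cong (λ S → substW x (rootLabels S) (children S) T) (isLeafX-shape y S₂ ly))))
        (trans (graft-relabelled-leaf x y S₃ T r₃ u h) (sym (cong (λ S → graft x S T) (graft-red-leaf y S₃ S₂ r₃ ly)))))
  (λ ly → trans (cong (graft y S₃) (graft-white x S₂ T r₂))
   (trans (graft-red y S₃ (substW x L₂ C₂ T) r₃ (isLeafX-substW-absent x y L₂ C₂ T u h ly))
    (trans (substR-substW x y L₂ C₂ S₃ T u h ly)
     (sym (trans (cong (λ S → graft x S T) (graft-red y S₃ S₂ r₃ ly))
                 (graft-white x (substR y S₃ S₂) T (trans (isRed-substR y S₃ S₂ r₃) r₂)))))))

graft-into-red : ∀ x y S₂ S₃ T → isRed S₂ ≡ true → Distinct (labels T) → elem y (del x (labels T)) ≡ false →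
  graft y S₃ (substR x S₂ T) ≡ substR x (graft y S₃ S₂) T
graft-into-red x y S₂ S₃@(node L₃ C₃) T r₂ u h = by-cases (isRed S₃)
  (λ r₃ → trans (graft-red y S₃ (substR x S₂ T) r₃ (isLeafX-substR-absent x y S₂ T h))
                (trans (substR-substR x y S₃ S₂ T r₂ u h)
                       (cong (λ S → substR x S T) (sym (graft-red y S₃ S₂ r₃ (isLeafX-red y S₂ r₂))))))
  (λ r₃ → trans (graft-white y S₃ (substR x S₂ T) r₃)
                    (trans (substW-substR x y L₃ C₃ S₂ T r₂ u h) (cong (λ S → substR x S T) (sym (graft-white y S₃ S₂ r₃)))))

graft-sequential-red : ∀ x y S₂ S₃ T → isRed S₂ ≡ true →
  Distinct (labels T) → elem y (del x (labels T)) ≡ false → graft y S₃ (graft x S₂ T) ≡ graft x (graft y S₃ S₂) T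
graft-sequential-red x y S₂ S₃ T r₂ u h = by-cases (isLeafX x T)
  (λ lx → trans (cong (graft y S₃) (graft-red-leaf x S₂ T r₂ lx)) (sym (graft-red-leaf x (graft y S₃ S₂) T r₂′ lx)))
  (λ lx → trans (cong (graft y S₃) (graft-red x S₂ T r₂ lx))
                (trans (graft-into-red x y S₂ S₃ T r₂ u h) (sym (graft-red x (graft y S₃ S₂) T r₂′ lx))))
  where
    r₂′ : isRed (graft y S₃ S₂) ≡ true
    r₂′ = trans (isRed-graft y S₃ S₂ (λ _ → isLeafX-red y S₂ r₂)) r₂

graft-sequential : ∀ x y S₂ S₃ T → Distinct (labels T) → elem y (del x (labels T)) ≡ false →
         graft y S₃ (graft x S₂ T) ≡ graft x (graft y S₃ S₂) T
graft-sequential x y S₂ S₃ T u h = by-cases (isRed S₂)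
  (λ r₂ → graft-sequential-red x y S₂ S₃ T r₂ u h)
  (λ r₂ → by-cases (isRed S₃) (λ r₃ → graft-sequential-white-red x y S₂ S₃ T r₂ r₃ u h)
                              (λ r₃ → graft-sequential-white-white x y S₂ S₃ T r₂ r₃ u h))

-- Parallel interchange: grafts at two distinct labels x, y of T commute up to
-- isomorphism (the children of a node may end up in a different order).

isLeafX-substW-other : ∀ x y L₂ C₂ t → isRed (node L₂ C₂) ≡ false → elem y L₂ ≡ false → x ≢ y →
     isLeafX y (substW x L₂ C₂ t) ≡ isLeafX y t
isLeafX-substW-other x y L₂ C₂ (node L C) r ey n with elem x L in e
... | true = trans (merged-not-leaf (del x L) L₂ C C₂ r ey) (sym (isLeafX-other x y L C e n))
  where
    merged-not-leaf : ∀ M L₂ C C₂ → isRed (node L₂ C₂) ≡ false → elem y L₂ ≡ false → isLeafX y (node (M ++ L₂) (C ++ C₂)) ≡ false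
    merged-not-leaf M L₂ C (c ∷ C₂) r ey = isLeafX-children y (M ++ L₂) (C ++ c ∷ C₂) (subst (1 ≤_) (sym (length-++ C)) (≤-trans (s≤s z≤n) (m≤n+m (suc (length C₂)) (length C))))
    merged-not-leaf M [] C [] () ey
    merged-not-leaf [] (b ∷ []) [] [] r ey = proj₁ (∨-false⁻ _ _ ey)
    merged-not-leaf [] (b ∷ []) (_ ∷ _) [] r ey = refl
    merged-not-leaf [] (b ∷ _ ∷ _) C [] r ey = refl
    merged-not-leaf (a ∷ M) (b ∷ L₂) C [] r ey = two-labels a M b L₂ (C ++ [])
      where two-labels : ∀ a M b L₂ D → isLeafX y (node (a ∷ M ++ b ∷ L₂) D) ≡ false
            two-labels a [] b L₂ D = refl
            two-labels a (_ ∷ _) b L₂ D = refl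
... | false = same-arity C (substWF x L₂ C₂ C) (length-substWF x L₂ C₂ C)
  where
    same-arity : ∀ C D → length D ≡ length C → isLeafX y (node L D) ≡ isLeafX y (node L C)
    same-arity [] [] p = refl
    same-arity (c ∷ C) (d ∷ D) p = trans (isLeafX-inner y L d D) (sym (isLeafX-inner y L c C))

isLeafX-substR-other : ∀ x y S t → 1 ≤ length (children S) → x ≢ y → isLeafX y (substR x S t) ≡ isLeafX y t
isLeafX-substR-other x y S (node L C) p n with elem x L in e
... | true = trans (isLeafX-snoc y (del x L) C S) (sym (isLeafX-other x y L C e n))
... | false = below C
  where
    below : ∀ C → isLeafX y (node L (substRF x S C)) ≡ isLeafX y (node L C)
    below [] = refl
    below (c ∷ C) = trans (isLeafX-children y L _ (≤-trans (s≤s z≤n) (length-substRF x S (c ∷ C) p))) (sym (isLeafX-inner y L c C))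

mutual
  substW-comm : ∀ x y L₂ C₂ L₃ C₃ T → x ≢ y → elem y L₂ ≡ false → elem y (labelsF C₂) ≡ false →
        elem x L₃ ≡ false → elem x (labelsF C₃) ≡ false →
        substW y L₃ C₃ (substW x L₂ C₂ T) ≅ substW x L₂ C₂ (substW y L₃ C₃ T)
  substW-comm x y L₂ C₂ L₃ C₃ (node L C) n y2 yC2 x3 xC3 = go (elem x L) (elem y L) refl refl
    where
      go : ∀ a b → elem x L ≡ a → elem y L ≡ b →
           substW y L₃ C₃ (substW x L₂ C₂ (node L C)) ≅ substW x L₂ C₂ (substW y L₃ C₃ (node L C))
      go true true ex ey =
        node≅-≡ (trans (cong (substW y L₃ C₃) (substW-here x L₂ C₂ L C ex))
                      (substW-here y L₃ C₃ (del x L ++ L₂) (C ++ C₂) (trans (elem-del-++-other x y L L₂ (≢-sym n) y2) ey)))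
               (trans (cong (substW x L₂ C₂) (substW-here y L₃ C₃ L C ey))
                      (substW-here x L₂ C₂ (del y L ++ L₃) (C ++ C₃) (trans (elem-del-++-other y x L L₃ n x3) ex)))
               (↭-trans (↭-reflexive (cong (_++ L₃) (trans (del-++ y (del x L) L₂) (cong (del y (del x L) ++_) (del-notin y L₂ y2)))))
                 (↭-trans (↭-swap-last (del y (del x L)) L₂ L₃)
                   (↭-reflexive (cong (_++ L₂) (sym (trans (del-++ x (del y L) L₃) (cong₂ _++_ (sym (del-comm x y L)) (del-notin x L₃ x3))))))))
               (~-swap-last C C₂ C₃)
      go true false ex ey = ≡⇒≅ (trans (cong (substW y L₃ C₃) (substW-here x L₂ C₂ L C ex))
          (trans (substW-below y L₃ C₃ (del x L ++ L₂) (C ++ C₂) (trans (elem-del-++-other x y L L₂ (≢-sym n) y2) ey))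
          (trans (cong (node (del x L ++ L₂)) (trans (substWF-++ y L₃ C₃ C C₂) (cong (substWF y L₃ C₃ C ++_) (substWF-absent y L₃ C₃ C₂ yC2))))
          (sym (trans (cong (substW x L₂ C₂) (substW-below y L₃ C₃ L C ey)) (substW-here x L₂ C₂ L (substWF y L₃ C₃ C) ex))))))
      go false true ex ey = ≡⇒≅ (trans (cong (substW y L₃ C₃) (substW-below x L₂ C₂ L C ex))
          (trans (substW-here y L₃ C₃ L (substWF x L₂ C₂ C) ey)
          (sym (trans (cong (substW x L₂ C₂) (substW-here y L₃ C₃ L C ey))
          (trans (substW-below x L₂ C₂ (del y L ++ L₃) (C ++ C₃) (trans (elem-del-++-other y x L L₃ n x3) ex))
           (cong (node (del y L ++ L₃)) (trans (substWF-++ x L₂ C₂ C C₃) (cong (substWF x L₂ C₂ C ++_) (substWF-absent x L₂ C₂ C₃ xC3)))))))))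
      go false false ex ey =
        node≅-≡ (trans (cong (substW y L₃ C₃) (substW-below x L₂ C₂ L C ex)) (substW-below y L₃ C₃ L (substWF x L₂ C₂ C) ey))
               (trans (cong (substW x L₂ C₂) (substW-below y L₃ C₃ L C ey)) (substW-below x L₂ C₂ L (substWF y L₃ C₃ C) ex))
               ↭-refl (H.refl (substWF-comm x y L₂ C₂ L₃ C₃ C n y2 yC2 x3 xC3))

  substWF-comm : ∀ x y L₂ C₂ L₃ C₃ C → x ≢ y → elem y L₂ ≡ false → elem y (labelsF C₂) ≡ false →
        elem x L₃ ≡ false → elem x (labelsF C₃) ≡ false →
        Pointwise _≅_ (substWF y L₃ C₃ (substWF x L₂ C₂ C)) (substWF x L₂ C₂ (substWF y L₃ C₃ C))
  substWF-comm x y L₂ C₂ L₃ C₃ [] n y2 yC2 x3 xC3 = []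
  substWF-comm x y L₂ C₂ L₃ C₃ (t ∷ C) n y2 yC2 x3 xC3 = substW-comm x y L₂ C₂ L₃ C₃ t n y2 yC2 x3 xC3 ∷ substWF-comm x y L₂ C₂ L₃ C₃ C n y2 yC2 x3 xC3

mutual
  substR-substW-comm : ∀ x y L₂ C₂ S₃ T → x ≢ y → isRed (node L₂ C₂) ≡ false → isRed S₃ ≡ true → 1 ≤ length (children S₃) →
        elem y L₂ ≡ false → elem y (labelsF C₂) ≡ false → elem x (labels S₃) ≡ false →
        substR y S₃ (substW x L₂ C₂ T) ≅ substW x L₂ C₂ (substR y S₃ T)
  substR-substW-comm x y L₂ C₂ S₃ (node L C) n r2 r3 c3 y2 yC2 x3 = go (elem x L) (elem y L) refl refl
    where
      go : ∀ a b → elem x L ≡ a → elem y L ≡ b →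
           substR y S₃ (substW x L₂ C₂ (node L C)) ≅ substW x L₂ C₂ (substR y S₃ (node L C))
      go true true ex ey =
        node≅-≡ (trans (cong (substR y S₃) (substW-here x L₂ C₂ L C ex))
                      (substR-here y S₃ (del x L ++ L₂) (C ++ C₂) (trans (elem-del-++-other x y L L₂ (≢-sym n) y2) ey)))
               (trans (cong (substW x L₂ C₂) (substR-here y S₃ L C ey))
                      (substW-here x L₂ C₂ (del y L) (C ++ (S₃ ∷ [])) (trans (elem-del-other y x L n) ex)))
               (↭-reflexive (trans (del-++ y (del x L) L₂) (cong₂ _++_ (del-comm x y L) (del-notin y L₂ y2))))
               (~-swap-last C C₂ (S₃ ∷ []))
      go true false ex ey = ≡⇒≅ (trans (cong (substR y S₃) (substW-here x L₂ C₂ L C ex))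
          (trans (substR-below y S₃ (del x L ++ L₂) (C ++ C₂) (trans (elem-del-++-other x y L L₂ (≢-sym n) y2) ey))
          (trans (cong (node (del x L ++ L₂)) (trans (substRF-++ y S₃ C C₂) (cong (substRF y S₃ C ++_) (substRF-absent y S₃ C₂ yC2))))
          (sym (trans (cong (substW x L₂ C₂) (substR-below y S₃ L C ey)) (substW-here x L₂ C₂ L (substRF y S₃ C) ex))))))
      go false true ex ey = ≡⇒≅ (trans (cong (substR y S₃) (substW-below x L₂ C₂ L C ex))
          (trans (substR-here y S₃ L (substWF x L₂ C₂ C) ey)
          (sym (trans (cong (substW x L₂ C₂) (substR-here y S₃ L C ey))
          (trans (substW-below x L₂ C₂ (del y L) (C ++ (S₃ ∷ [])) (trans (elem-del-other y x L n) ex))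
           (cong (node (del y L)) (trans (substWF-++ x L₂ C₂ C (S₃ ∷ [])) (cong (λ s → substWF x L₂ C₂ C ++ (s ∷ [])) (substW-absent x L₂ C₂ S₃ x3)))))))))
      go false false ex ey =
        node≅-≡ (trans (cong (substR y S₃) (substW-below x L₂ C₂ L C ex)) (substR-below y S₃ L (substWF x L₂ C₂ C) ey))
               (trans (cong (substW x L₂ C₂) (substR-below y S₃ L C ey)) (substW-below x L₂ C₂ L (substRF y S₃ C) ex))
               ↭-refl (substRF-substWF-comm x y L₂ C₂ S₃ C n r2 r3 c3 y2 yC2 x3)

  substRF-substWF-comm : ∀ x y L₂ C₂ S₃ C → x ≢ y → isRed (node L₂ C₂) ≡ false → isRed S₃ ≡ true → 1 ≤ length (children S₃) →
        elem y L₂ ≡ false → elem y (labelsF C₂) ≡ false → elem x (labels S₃) ≡ false →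
        substRF y S₃ (substWF x L₂ C₂ C) ~ substWF x L₂ C₂ (substRF y S₃ C)
  substRF-substWF-comm x y L₂ C₂ S₃ [] n r2 r3 c3 y2 yC2 x3 = ~-refl
  substRF-substWF-comm x y L₂ C₂ S₃ (t ∷ C) n r2 r3 c3 y2 yC2 x3 = go (isLeafX y t) refl
    where
      go : ∀ b → isLeafX y t ≡ b → substRF y S₃ (substWF x L₂ C₂ (t ∷ C)) ~ substWF x L₂ C₂ (substRF y S₃ (t ∷ C))
      go true l = ~-subst₂ (substRF-leaf y S₃ (substW x L₂ C₂ t) (substWF x L₂ C₂ C) (trans (isLeafX-substW-other x y L₂ C₂ t r2 y2 n) l))
                          (trans (cong (substWF x L₂ C₂) (substRF-leaf y S₃ t C l))
                             (trans (substWF-++ x L₂ C₂ (children S₃) _) (cong (_++ substWF x L₂ C₂ (substRF y S₃ C)) (substWF-absent x L₂ C₂ _ (elem-children-absent x S₃ x3)))))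
                          (TreePerm.++⁺ˡ (children S₃) (substRF-substWF-comm x y L₂ C₂ S₃ C n r2 r3 c3 y2 yC2 x3))
      go false l = ~-subst₂ (substRF-nonleaf y S₃ (substW x L₂ C₂ t) (substWF x L₂ C₂ C) (trans (isLeafX-substW-other x y L₂ C₂ t r2 y2 n) l))
                           (cong (substWF x L₂ C₂) (substRF-nonleaf y S₃ t C l))
                           (H.prep (substR-substW-comm x y L₂ C₂ S₃ t n r2 r3 c3 y2 yC2 x3) (substRF-substWF-comm x y L₂ C₂ S₃ C n r2 r3 c3 y2 yC2 x3))

mutual
  substR-comm : ∀ x y S₂ S₃ T → x ≢ y → isRed S₂ ≡ true → isRed S₃ ≡ true → 1 ≤ length (children S₂) → 1 ≤ length (children S₃) →
        elem y (labels S₂) ≡ false → elem x (labels S₃) ≡ false →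
        substR y S₃ (substR x S₂ T) ≅ substR x S₂ (substR y S₃ T)
  substR-comm x y S₂ S₃ (node L C) n r2 r3 c2 c3 y2 x3 = go (elem x L) (elem y L) refl refl
    where
      go : ∀ a b → elem x L ≡ a → elem y L ≡ b →
           substR y S₃ (substR x S₂ (node L C)) ≅ substR x S₂ (substR y S₃ (node L C))
      go true true ex ey =
        node≅-≡ (trans (cong (substR y S₃) (substR-here x S₂ L C ex))
                      (substR-here y S₃ (del x L) (C ++ (S₂ ∷ [])) (trans (elem-del-other x y L (≢-sym n)) ey)))
               (trans (cong (substR x S₂) (substR-here y S₃ L C ey))
                      (substR-here x S₂ (del y L) (C ++ (S₃ ∷ [])) (trans (elem-del-other y x L n) ex)))
               (↭-reflexive (del-comm x y L))
               (~-swap-last C (S₂ ∷ []) (S₃ ∷ []))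
      go true false ex ey = ≡⇒≅ (trans (cong (substR y S₃) (substR-here x S₂ L C ex))
          (trans (substR-below y S₃ (del x L) (C ++ (S₂ ∷ [])) (trans (elem-del-other x y L (≢-sym n)) ey))
          (trans (cong (node (del x L)) (trans (substRF-++ y S₃ C (S₂ ∷ []))
                    (cong (substRF y S₃ C ++_) (trans (substRF-nonleaf y S₃ S₂ [] (isLeafX-red y S₂ r2)) (cong (_∷ []) (substR-absent y S₃ S₂ y2))))))
          (sym (trans (cong (substR x S₂) (substR-below y S₃ L C ey)) (substR-here x S₂ L (substRF y S₃ C) ex))))))
      go false true ex ey = ≡⇒≅ (trans (cong (substR y S₃) (substR-below x S₂ L C ex))
          (trans (substR-here y S₃ L (substRF x S₂ C) ey)
          (sym (trans (cong (substR x S₂) (substR-here y S₃ L C ey))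
          (trans (substR-below x S₂ (del y L) (C ++ (S₃ ∷ [])) (trans (elem-del-other y x L n) ex))
           (cong (node (del y L)) (trans (substRF-++ x S₂ C (S₃ ∷ []))
              (cong (substRF x S₂ C ++_) (trans (substRF-nonleaf x S₂ S₃ [] (isLeafX-red x S₃ r3)) (cong (_∷ []) (substR-absent x S₂ S₃ x3)))))))))))
      go false false ex ey =
        node≅-≡ (trans (cong (substR y S₃) (substR-below x S₂ L C ex)) (substR-below y S₃ L (substRF x S₂ C) ey))
               (trans (cong (substR x S₂) (substR-below y S₃ L C ey)) (substR-below x S₂ L (substRF y S₃ C) ex))
               ↭-refl (substRF-comm x y S₂ S₃ C n r2 r3 c2 c3 y2 x3)

  substRF-comm : ∀ x y S₂ S₃ C → x ≢ y → isRed S₂ ≡ true → isRed S₃ ≡ true → 1 ≤ length (children S₂) → 1 ≤ length (children S₃) →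
        elem y (labels S₂) ≡ false → elem x (labels S₃) ≡ false →
        substRF y S₃ (substRF x S₂ C) ~ substRF x S₂ (substRF y S₃ C)
  substRF-comm x y S₂ S₃ [] n r2 r3 c2 c3 y2 x3 = ~-refl
  substRF-comm x y S₂ S₃ (t ∷ C) n r2 r3 c2 c3 y2 x3 = go (isLeafX x t) (isLeafX y t) refl refl
    where
      IH = substRF-comm x y S₂ S₃ C n r2 r3 c2 c3 y2 x3
      go : ∀ a b → isLeafX x t ≡ a → isLeafX y t ≡ b → substRF y S₃ (substRF x S₂ (t ∷ C)) ~ substRF x S₂ (substRF y S₃ (t ∷ C))
      go true b lx ly =
        ~-subst₂ (trans (cong (substRF y S₃) (substRF-leaf x S₂ t C lx))
                   (trans (substRF-++ y S₃ (children S₂) _) (cong (_++ substRF y S₃ (substRF x S₂ C)) (substRF-absent y S₃ _ (elem-children-absent y S₂ y2)))))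
                (trans (cong (substRF x S₂) (substRF-nonleaf y S₃ t C (isLeafX-unique x y t lx n)))
                   (trans (cong (λ s → substRF x S₂ (s ∷ substRF y S₃ C)) (substR-absent y S₃ t (isLeafX-other-absent x y t lx n)))
                     (substRF-leaf x S₂ t (substRF y S₃ C) lx)))
                (TreePerm.++⁺ˡ (children S₂) IH)
      go false true lx ly =
        ~-subst₂ (trans (cong (substRF y S₃) (substRF-nonleaf x S₂ t C lx))
                   (trans (cong (λ s → substRF y S₃ (s ∷ substRF x S₂ C)) (substR-absent x S₂ t (isLeafX-other-absent y x t ly (≢-sym n))))
                     (substRF-leaf y S₃ t (substRF x S₂ C) ly)))
                (trans (cong (substRF x S₂) (substRF-leaf y S₃ t C ly))
                   (trans (substRF-++ x S₂ (children S₃) _) (cong (_++ substRF x S₂ (substRF y S₃ C)) (substRF-absent x S₂ _ (elem-children-absent x S₃ x3)))))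
                (TreePerm.++⁺ˡ (children S₃) IH)
      go false false lx ly =
        ~-subst₂ (trans (cong (substRF y S₃) (substRF-nonleaf x S₂ t C lx)) (substRF-nonleaf y S₃ (substR x S₂ t) (substRF x S₂ C) (trans (isLeafX-substR-other x y S₂ t c2 n) ly)))
                (trans (cong (substRF x S₂) (substRF-nonleaf y S₃ t C ly)) (substRF-nonleaf x S₂ (substR y S₃ t) (substRF y S₃ C) (trans (isLeafX-substR-other y x S₃ t c3 (≢-sym n)) lx)))
                (H.prep (substR-comm x y S₂ S₃ t n r2 r3 c2 c3 y2 x3) IH)

graft-parallel : ∀ x y S₂ S₃ T → x ≢ y → elem x (labels T) ≡ true → elem y (labels T) ≡ true →
         elem y (labels S₂) ≡ false → elem x (labels S₃) ≡ false → Branching S₂ → Branching S₃ →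
         graft y S₃ (graft x S₂ T) ≅ graft x S₂ (graft y S₃ T)
graft-parallel x y S₂@(node L₂ C₂) S₃@(node L₃ C₃) T n ex ey y2 x3 b2 b3 = go (isRed S₂) (isRed S₃) refl refl
  where
    lxT = labelled⇒¬isLeafX x y T ey n
    lyT = labelled⇒¬isLeafX y x T ex (≢-sym n)
    c2 : isRed S₂ ≡ true → 1 ≤ length C₂
    c2 r = ≤-trans (s≤s z≤n) (red-branching S₂ b2 r)
    c3 : isRed S₃ ≡ true → 1 ≤ length C₃
    c3 r = ≤-trans (s≤s z≤n) (red-branching S₃ b3 r)
    go : ∀ a b → isRed S₂ ≡ a → isRed S₃ ≡ b → graft y S₃ (graft x S₂ T) ≅ graft x S₂ (graft y S₃ T)
    go false false r2 r3 =
      ≅-trans (≡⇒≅ (trans (cong (graft y S₃) (graft-white x S₂ T r2)) (graft-white y S₃ (substW x L₂ C₂ T) r3)))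
      (≅-trans (substW-comm x y L₂ C₂ L₃ C₃ T n (elem-rootLabels-absent y S₂ y2) (elem-children-absent y S₂ y2) (elem-rootLabels-absent x S₃ x3) (elem-children-absent x S₃ x3))
        (≡⇒≅ (sym (trans (cong (graft x S₂) (graft-white y S₃ T r3)) (graft-white x S₂ (substW y L₃ C₃ T) r2)))))
    go false true r2 r3 =
      ≅-trans (≡⇒≅ (trans (cong (graft y S₃) (graft-white x S₂ T r2))
                 (graft-red y S₃ (substW x L₂ C₂ T) r3 (trans (isLeafX-substW-other x y L₂ C₂ T r2 (elem-rootLabels-absent y S₂ y2) n) lyT))))
      (≅-trans (substR-substW-comm x y L₂ C₂ S₃ T n r2 r3 (c3 r3) (elem-rootLabels-absent y S₂ y2) (elem-children-absent y S₂ y2) x3)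
        (≡⇒≅ (sym (trans (cong (graft x S₂) (graft-red y S₃ T r3 lyT)) (graft-white x S₂ (substR y S₃ T) r2)))))
    go true false r2 r3 =
      ≅-trans (≡⇒≅ (trans (cong (graft y S₃) (graft-red x S₂ T r2 lxT)) (graft-white y S₃ (substR x S₂ T) r3)))
      (≅-trans (≅-sym (substR-substW-comm y x L₃ C₃ S₂ T (≢-sym n) r3 r2 (c2 r2) (elem-rootLabels-absent x S₃ x3) (elem-children-absent x S₃ x3) y2))
        (≡⇒≅ (sym (trans (cong (graft x S₂) (graft-white y S₃ T r3))
                 (graft-red x S₂ (substW y L₃ C₃ T) r2 (trans (isLeafX-substW-other y x L₃ C₃ T r3 (elem-rootLabels-absent x S₃ x3) (≢-sym n)) lxT))))))
    go true true r2 r3 =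
      ≅-trans (≡⇒≅ (trans (cong (graft y S₃) (graft-red x S₂ T r2 lxT))
                 (graft-red y S₃ (substR x S₂ T) r3 (trans (isLeafX-substR-other x y S₂ T (c2 r2) n) lyT))))
      (≅-trans (substR-comm x y S₂ S₃ T n r2 r3 (c2 r2) (c3 r3) y2 x3)
        (≡⇒≅ (sym (trans (cong (graft x S₂) (graft-red y S₃ T r3 lyT))
                 (graft-red x S₂ (substR y S₃ T) r2 (trans (isLeafX-substR-other y x S₃ T (c3 r3) (≢-sym n)) lxT))))))

range : ℕ → ℕ → List ℕ
range a zero = []
range a (suc n) = a ∷ range (suc a) n

applyUpTo-range : ∀ (f : ℕ → ℕ) a n → (∀ i → f i ≡ a + i) → applyUpTo f n ≡ range a n
applyUpTo-range f a zero h = refl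
applyUpTo-range f a (suc n) h = cong₂ _∷_ (trans (h 0) (+-identityʳ a))
  (applyUpTo-range (f ∘ suc) (suc a) n (λ i → trans (h (suc i)) (+-suc a i)))

oneTo≡range : ∀ n → oneTo n ≡ range 1 n
oneTo≡range n = trans (map-applyUpTo (λ i → i) suc n) (applyUpTo-range suc 1 n (λ i → refl))

length-range : ∀ a n → length (range a n) ≡ n
length-range a zero = refl
length-range a (suc n) = cong suc (length-range (suc a) n)

range-++ : ∀ a n p → range a (n + p) ≡ range a n ++ range (a + n) p
range-++ a zero p = cong (λ b → range b p) (sym (+-identityʳ a))
range-++ a (suc n) p = cong (a ∷_) (trans (range-++ (suc a) n p) (cong (λ b → range (suc a) n ++ range b p) (sym (+-suc a n))))

range-bounds : ∀ a n → All (λ z → a ≤ z × z < a + n) (range a n)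
range-bounds a zero = []
range-bounds a (suc n) = (≤-refl , subst (a <_) (sym (+-suc a n)) (s≤s (m≤m+n a n)))
   ∷ All.map step (range-bounds (suc a) n)
  where step : ∀ {z} → suc a ≤ z × z < suc a + n → a ≤ z × z < a + suc n
        step {z} (p , q) = <⇒≤ p , subst (z <_) (sym (+-suc a n)) q

range-outside : ∀ z a n → (z < a ⊎ a + n ≤ z) → elem z (range a n) ≡ false
range-outside z a n h = all≢⇒elem-false z (range a n) (All.map (λ { (p , q) refl → outside h p q }) (range-bounds a n))
  where outside : (z < a ⊎ a + n ≤ z) → a ≤ z → z < a + n → ⊥
        outside (inj₁ x) p q = <⇒≱ x p
        outside (inj₂ y) p q = <⇒≱ q y

range-inside : ∀ z a n → a ≤ z → z < a + n → elem z (range a n) ≡ true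
range-inside z a zero p q = ⊥-elim (<⇒≱ q (subst (_≤ z) (sym (+-identityʳ a)) p))
range-inside z a (suc n) p q with a ≡ᵇ z | ≡ᵇ-view a z
... | true | _ = refl
... | false | unequal ne = range-inside z (suc a) n (≤∧≢⇒< p ne) (subst (z <_) (+-suc a n) q)

range-distinct : ∀ a n → Distinct (range a n)
range-distinct a zero = tt
range-distinct a (suc n) = range-outside a (suc a) n (inj₁ ≤-refl) , range-distinct (suc a) n

map-range : ∀ (f : ℕ → ℕ) a c n → (∀ z → a ≤ z → z < a + n → f z ≡ z + c) → map f (range a n) ≡ range (a + c) n
map-range f a c zero h = refl
map-range f a c (suc n) h = cong₂ _∷_ (h a ≤-refl (subst (a <_) (sym (+-suc a n)) (s≤s (m≤m+n a n))))
  (map-range f (suc a) c n (λ z p q → h z (≤-trans (n≤1+n a) p) (subst (z <_) (sym (+-suc a n)) q)))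

+∸1 : ∀ y k → 1 ≤ k → y + k ∸ 1 ≡ y + (k ∸ 1)
+∸1 y (suc k) p = trans (cong (_∸ 1) (+-suc y k)) refl

+suc∸1 : ∀ p q → p + suc q ∸ 1 ≡ p + q
+suc∸1 p q = cong (_∸ 1) (+-suc p q)

shiftAbove-≤ : ∀ x k y → y ≤ x → shiftAbove x k y ≡ y
shiftAbove-≤ x k y p with x <? y
... | yes q = ⊥-elim (<⇒≱ q p)
... | no _ = refl

shiftAbove-> : ∀ x k y → x < y → shiftAbove x k y ≡ y + k ∸ 1
shiftAbove-> x k y p with x <? y
... | yes _ = refl
... | no q = ⊥-elim (q p)

shiftAbove-injective : ∀ x k → 1 ≤ k → ∀ a b → shiftAbove x k a ≡ shiftAbove x k b → a ≡ b
shiftAbove-injective x k k1 a b e with x <? a | x <? b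
... | yes p | yes q = +-cancelʳ-≡ (k ∸ 1) a b (trans (sym (+∸1 a k k1)) (trans e (+∸1 b k k1)))
... | no p | no q = e
... | yes p | no q = ⊥-elim (q (<-≤-trans p (≤-trans (m≤m+n a (k ∸ 1)) (≤-reflexive (trans (sym (+∸1 a k k1)) e)))))
... | no p | yes q = ⊥-elim (p (<-≤-trans q (≤-trans (m≤m+n b (k ∸ 1)) (≤-reflexive (trans (sym (+∸1 b k k1)) (sym e))))))

shiftAbove-1 : ∀ x y → shiftAbove x 1 y ≡ y
shiftAbove-1 x y with x <? y
... | yes _ = m+n∸n≡m y 1
... | no _ = refl

offset : ℕ → ℕ → ℕ
offset x y = y + x ∸ 1

offset-injective : ∀ x → 1 ≤ x → ∀ a b → offset x a ≡ offset x b → a ≡ b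
offset-injective x x1 a b e = +-cancelʳ-≡ (x ∸ 1) a b (trans (sym (+∸1 a x x1)) (trans e (+∸1 b x x1)))

shiftAbove-shiftAbove : ∀ a d k′ l′ → d ≤ k′ → ∀ z →
       shiftAbove (suc a + d) (suc l′) (shiftAbove (suc a) (suc k′) z) ≡ shiftAbove (suc a) (suc k′ + suc l′ ∸ 1) z
shiftAbove-shiftAbove a d k′ l′ dk z with z ≤? suc a
... | yes p rewrite shiftAbove-≤ (suc a) (suc k′) z p | shiftAbove-≤ (suc a) (k′ + suc l′) z p = shiftAbove-≤ (suc a + d) (suc l′) z (≤-trans p (m≤m+n (suc a) d))
... | no p rewrite shiftAbove-> (suc a) (suc k′) z (≰⇒> p) | shiftAbove-> (suc a) (k′ + suc l′) z (≰⇒> p) | +suc∸1 z k′ =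
  trans (shiftAbove-> (suc a + d) (suc l′) (z + k′) lt)
        (trans (+suc∸1 (z + k′) l′)
               (trans (+-assoc z k′ l′) (trans (sym (+suc∸1 z (k′ + l′))) (cong (λ w → z + w ∸ 1) (sym (+-suc k′ l′))))))
  where
    lt : suc a + d < z + k′
    lt = ≤-<-trans (+-monoʳ-≤ (suc a) dk) (+-monoˡ-< k′ (≰⇒> p))

shiftAbove-offset : ∀ a d l′ z → shiftAbove (suc a + d) (suc l′) (offset (suc a) z) ≡ offset (suc a) (shiftAbove (suc d) (suc l′) z)
shiftAbove-offset a d l′ z with z ≤? suc d
... | yes p = trans (shiftAbove-≤ (suc a + d) (suc l′) (offset (suc a) z)
                      (subst (_≤ suc a + d) (sym (+suc∸1 z a)) (≤-trans (+-monoˡ-≤ a p) (≤-reflexive (cong suc (+-comm d a))))))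
                    (cong (offset (suc a)) (sym (shiftAbove-≤ (suc d) (suc l′) z p)))
... | no p = trans (shiftAbove-> (suc a + d) (suc l′) (offset (suc a) z)
                      (subst (suc a + d <_) (sym (+suc∸1 z a)) (subst (_< z + a) (cong suc (+-comm d a)) (+-monoˡ-< a (≰⇒> p)))))
                   (trans eq (cong (offset (suc a)) (sym (shiftAbove-> (suc d) (suc l′) z (≰⇒> p)))))
  where
    open ≡-Reasoning
    eq : offset (suc a) z + suc l′ ∸ 1 ≡ offset (suc a) (z + suc l′ ∸ 1)
    eq = begin
      (z + suc a ∸ 1) + suc l′ ∸ 1 ≡⟨ cong (λ w → w + suc l′ ∸ 1) (+suc∸1 z a) ⟩
      (z + a) + suc l′ ∸ 1         ≡⟨ +suc∸1 (z + a) l′ ⟩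
      z + a + l′                   ≡⟨ +-assoc z a l′ ⟩
      z + (a + l′)                 ≡⟨ cong (z +_) (+-comm a l′) ⟩
      z + (l′ + a)                 ≡⟨ sym (+-assoc z l′ a) ⟩
      z + l′ + a                   ≡⟨ sym (+suc∸1 (z + l′) a) ⟩
      (z + l′) + suc a ∸ 1         ≡⟨ cong (λ w → w + suc a ∸ 1) (sym (+suc∸1 z l′)) ⟩
      (z + suc l′ ∸ 1) + suc a ∸ 1 ∎

offset-offset : ∀ a d z → offset (suc a + d) z ≡ offset (suc a) (offset (suc d) z)
offset-offset a d z = begin
    z + (suc a + d) ∸ 1  ≡⟨ +suc∸1 z (a + d) ⟩
    z + (a + d)          ≡⟨ cong (z +_) (+-comm a d) ⟩
    z + (d + a)          ≡⟨ sym (+-assoc z d a) ⟩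
    z + d + a            ≡⟨ sym (+suc∸1 (z + d) a) ⟩
    (z + d) + suc a ∸ 1  ≡⟨ cong (λ w → w + suc a ∸ 1) (sym (+suc∸1 z d)) ⟩
    (z + suc d ∸ 1) + suc a ∸ 1 ∎
  where open ≡-Reasoning

shiftAbove-comm : ∀ a k′ l′ y → suc a < y → ∀ z →
      shiftAbove (y + k′) (suc l′) (shiftAbove (suc a) (suc k′) z) ≡ shiftAbove (suc a) (suc k′) (shiftAbove y (suc l′) z)
shiftAbove-comm a k′ l′ y xy z with z ≤? suc a
... | yes p = trans (cong (shiftAbove (y + k′) (suc l′)) (shiftAbove-≤ (suc a) (suc k′) z p))
               (trans (shiftAbove-≤ (y + k′) (suc l′) z (≤-trans p (≤-trans (<⇒≤ xy) (m≤m+n y k′))))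
               (trans (sym (shiftAbove-≤ (suc a) (suc k′) z p)) (cong (shiftAbove (suc a) (suc k′)) (sym (shiftAbove-≤ y (suc l′) z (≤-trans p (<⇒≤ xy)))))))
... | no p with z ≤? y
...   | yes q = trans (cong (shiftAbove (y + k′) (suc l′)) (trans (shiftAbove-> (suc a) (suc k′) z (≰⇒> p)) (+suc∸1 z k′)))
                 (trans (shiftAbove-≤ (y + k′) (suc l′) (z + k′) (+-monoˡ-≤ k′ q))
                 (trans (sym (trans (shiftAbove-> (suc a) (suc k′) z (≰⇒> p)) (+suc∸1 z k′))) (cong (shiftAbove (suc a) (suc k′)) (sym (shiftAbove-≤ y (suc l′) z q)))))
...   | no q = trans (cong (shiftAbove (y + k′) (suc l′)) (trans (shiftAbove-> (suc a) (suc k′) z (≰⇒> p)) (+suc∸1 z k′)))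
                 (trans (trans (shiftAbove-> (y + k′) (suc l′) (z + k′) (+-monoˡ-< k′ (≰⇒> q))) (+suc∸1 (z + k′) l′))
                 (trans (comm3 z k′ l′)
                 (sym (trans (cong (shiftAbove (suc a) (suc k′)) (trans (shiftAbove-> y (suc l′) z (≰⇒> q)) (+suc∸1 z l′)))
                   (trans (shiftAbove-> (suc a) (suc k′) (z + l′) (<-≤-trans (≰⇒> p) (m≤m+n z l′))) (+suc∸1 (z + l′) k′))))))
  where
    comm3 : ∀ z k′ l′ → z + k′ + l′ ≡ z + l′ + k′
    comm3 z k′ l′ = trans (+-assoc z k′ l′) (trans (cong (z +_) (+-comm k′ l′)) (sym (+-assoc z l′ k′)))

unshiftAbove : ℕ → ℕ → ℕ → ℕ
unshiftAbove x k w with x <? w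
... | yes _ = w ∸ (k ∸ 1)
... | no _ = w

unshiftAbove-shiftAbove : ∀ x k′ z → unshiftAbove x (suc k′) (shiftAbove x (suc k′) z) ≡ z
unshiftAbove-shiftAbove x k′ z with z ≤? x
... | yes p rewrite shiftAbove-≤ x (suc k′) z p with x <? z
...   | yes q = ⊥-elim (<⇒≱ q p)
...   | no _ = refl
unshiftAbove-shiftAbove x k′ z | no p rewrite shiftAbove-> x (suc k′) z (≰⇒> p) | +suc∸1 z k′ with x <? z + k′
...   | yes _ = m+n∸n≡m z k′
...   | no q = ⊥-elim (q (<-≤-trans (≰⇒> p) (m≤m+n z k′)))

valid-labels : ∀ {n T} → BWTSL n T → labels T ↭ range 1 n
valid-labels {n} (p , b) = ↭-trans p (↭-reflexive (oneTo≡range n))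

valid-distinct : ∀ {n T} → BWTSL n T → Distinct (labels T)
valid-distinct {n} v = Distinct-↭ (↭-sym (valid-labels v)) (range-distinct 1 n)

valid-bounds : ∀ {n T} → BWTSL n T → All (λ z → 1 ≤ z × z < 1 + n) (labels T)
valid-bounds {n} v = PPP.All-resp-↭ (↭-sym (valid-labels v)) (range-bounds 1 n)

valid-elem : ∀ {n T} → BWTSL n T → ∀ z → 1 ≤ z → z ≤ n → elem z (labels T) ≡ true
valid-elem {n} v z p q = trans (elem-cong z (valid-labels v)) (range-inside z 1 n p (s≤s q))

mutual
  labels-nonempty : ∀ T → Branching T → 1 ≤ length (labels T)
  labels-nonempty (node (a ∷ L) C) b = s≤s z≤n
  labels-nonempty (node [] C) (branching h a) = labelsF-nonempty C (≤-trans (s≤s z≤n) (h refl)) a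

  labelsF-nonempty : ∀ C → 1 ≤ length C → All Branching C → 1 ≤ length (labelsF C)
  labelsF-nonempty (c ∷ C) p (b ∷ a) = ≤-trans (labels-nonempty c b) (subst (length (labels c) ≤_) (sym (length-++ (labels c))) (m≤m+n _ _))

valid-weight-positive : ∀ {n T} → BWTSL n T → 1 ≤ n
valid-weight-positive {n} {T} v@(p , b) = subst (1 ≤_) (trans (PPP.↭-length (valid-labels v)) (length-range 1 n)) (labels-nonempty T b)

no-valid-tree-of-weight-0 : ∀ {T} → BWTSL 0 T → ⊥
no-valid-tree-of-weight-0 v with valid-weight-positive v
... | ()

labels-shifted : ∀ {m T₁} x k → BWTSL m T₁ → labels (relabel (shiftAbove x k) T₁) ↭ map (shiftAbove x k) (range 1 m)
labels-shifted {T₁ = T₁} x k v = ↭-trans (↭-reflexive (labels-relabel (shiftAbove x k) T₁)) (PPP.map⁺ (shiftAbove x k) (valid-labels v))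

distinct-shifted : ∀ {m T₁} x k → 1 ≤ k → BWTSL m T₁ → Distinct (labels (relabel (shiftAbove x k) T₁))
distinct-shifted {T₁ = T₁} x k k1 v = subst Distinct (sym (labels-relabel (shiftAbove x k) T₁)) (Distinct-map _ (labels T₁) (shiftAbove-injective x k k1) (valid-distinct v))

elem-shifted : ∀ {m T₁} x k → BWTSL m T₁ → 1 ≤ x → x ≤ m → elem x (labels (relabel (shiftAbove x k) T₁)) ≡ true
elem-shifted {T₁ = T₁} x k v p q = subst (λ z → elem z (labels (relabel (shiftAbove x k) T₁)) ≡ true) (shiftAbove-≤ x k x ≤-refl)
   (subst (λ L → elem (shiftAbove x k x) L ≡ true) (sym (labels-relabel (shiftAbove x k) T₁)) (elem-map-true (shiftAbove x k) x (labels T₁) (valid-elem v x p q)))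

isLeafX-shiftAbove : ∀ x k T → 1 ≤ k → isLeafX x (relabel (shiftAbove x k) T) ≡ isLeafX x T
isLeafX-shiftAbove x k T k1 = trans (cong (λ z → isLeafX z (relabel (shiftAbove x k) T)) (sym (shiftAbove-≤ x k x ≤-refl)))
                     (isLeafX-relabel (shiftAbove x k) (shiftAbove x k) x T (injective-compatible _ (shiftAbove-injective x k k1) x (labels T)))

-- compose is graft after renumbering (the leaf test is taken before renumbering).
compose≡graft : ∀ T₁ x k T₂ → 1 ≤ k → compose T₁ x k T₂ ≡ graft x (relabel (offset x) T₂) (relabel (shiftAbove x k) T₁)
compose≡graft T₁ x k T₂ k1 =
  cong (λ b → if isRed T₂′ then (if b then T₂′ else substR x T₂′ T₁′) else substW x (rootLabels T₂′) (children T₂′) T₁′)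
       (sym (isLeafX-shiftAbove x k T₁ k1))
  where T₂′ = relabel (offset x) T₂
        T₁′ = relabel (shiftAbove x k) T₁

relabel-compose : ∀ f x k T₁ T₂ {m} → (∀ a b → f a ≡ f b → a ≡ b) → 1 ≤ k → BWTSL m T₁ →
                  relabel f (compose T₁ x k T₂)
                    ≡ graft (f x) (relabel (f ∘ offset x) T₂) (relabel (f ∘ shiftAbove x k) T₁)
relabel-compose f x k T₁ T₂ f-inj k≥1 v₁ = begin
    relabel f (compose T₁ x k T₂)
  ≡⟨ cong (relabel f) (compose≡graft T₁ x k T₂ k≥1) ⟩
    relabel f (graft x (relabel (offset x) T₂) (relabel (shiftAbove x k) T₁))
  ≡⟨ relabel-graft f f x (relabel (offset x) T₂) (relabel (shiftAbove x k) T₁) (distinct-shifted x k k≥1 v₁)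
                     (injective-compatible f f-inj x (labels (relabel (shiftAbove x k) T₁))) ⟩
    graft (f x) (relabel f (relabel (offset x) T₂)) (relabel f (relabel (shiftAbove x k) T₁))
  ≡⟨ cong₂ (graft (f x)) (relabel-∘ f (offset x) T₂) (relabel-∘ f (shiftAbove x k) T₁) ⟩
    graft (f x) (relabel (f ∘ offset x) T₂) (relabel (f ∘ shiftAbove x k) T₁)
  ∎
  where open ≡-Reasoning

compose-compose : ∀ {m} T₁ T₂ T₃ x k y l → BWTSL m T₁ → 1 ≤ k → 1 ≤ l →
                  compose (compose T₁ x k T₂) y l T₃
                    ≡ graft y (relabel (offset y) T₃)
                        (graft (shiftAbove y l x) (relabel (shiftAbove y l ∘ offset x) T₂)
                                                  (relabel (shiftAbove y l ∘ shiftAbove x k) T₁))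
compose-compose T₁ T₂ T₃ x k y l v₁ k≥1 l≥1 =
  trans (compose≡graft (compose T₁ x k T₂) y l T₃ l≥1)
        (cong (graft y (relabel (offset y) T₃)) (relabel-compose (shiftAbove y l) x k T₁ T₂ (shiftAbove-injective y l l≥1) k≥1 v₁))

labels-compose-range : ∀ x′ r k′ → del (suc x′) (map (shiftAbove (suc x′) (suc k′)) (range 1 (suc x′ + r))) ++ map (offset (suc x′)) (range 1 (suc k′))
                    ↭ range 1 (suc x′ + r + suc k′ ∸ 1)
labels-compose-range x′ r k′ = ↭-trans (↭-reflexive lhs) (↭-trans (↭-rotate (range 1 x′) (range (2 + x′ + k′) r) (range (suc x′) (suc k′))) (↭-reflexive rhs))
  where
    x = suc x′
    f = shiftAbove x (suc k′)
    split : range 1 (suc x′ + r) ≡ range 1 x′ ++ (x ∷ range (suc x) r)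
    split = trans (cong (range 1) (sym (+-suc x′ r))) (range-++ 1 x′ (suc r))
    below-fixed : map f (range 1 x′) ≡ range 1 x′
    below-fixed = trans (map-range f 1 0 x′ (λ z p q → trans (shiftAbove-≤ x (suc k′) z (≤-trans (s≤s⁻¹ q) (n≤1+n x′))) (sym (+-identityʳ z)))) refl
    above-shifted : map f (range (suc x) r) ≡ range (2 + x′ + k′) r
    above-shifted = map-range f (suc x) k′ r (λ z p q → trans (shiftAbove-> x (suc k′) z p) (cong (_∸ 1) (+-suc z k′)))
    inserted : map (offset x) (range 1 (suc k′)) ≡ range (suc x′) (suc k′)
    inserted = trans (map-range (offset x) 1 x′ (suc k′) (λ z p q → cong (_∸ 1) (+-suc z x′))) refl
    del-below : del x (range 1 x′) ≡ range 1 x′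
    del-below = del-notin x (range 1 x′) (range-outside x 1 x′ (inj₂ ≤-refl))
    del-above : del x (range (2 + x′ + k′) r) ≡ range (2 + x′ + k′) r
    del-above = del-notin x _ (range-outside x (2 + x′ + k′) r (inj₁ (s≤s (s≤s (m≤m+n x′ k′)))))
    lhs : del x (map f (range 1 (suc x′ + r))) ++ map (offset x) (range 1 (suc k′)) ≡ (range 1 x′ ++ range (2 + x′ + k′) r) ++ range (suc x′) (suc k′)
    lhs = cong₂ _++_ (trans (cong (λ L → del x (map f L)) split)
                     (trans (cong (del x) (map-++ f (range 1 x′) (x ∷ range (suc x) r)))
                     (trans (del-++ x (map f (range 1 x′)) (f x ∷ map f (range (suc x) r)))
                     (cong₂ _++_ (trans (cong (del x) below-fixed) del-below)
                        (trans (cong (λ z → del x (z ∷ map f (range (suc x) r))) (shiftAbove-≤ x (suc k′) x ≤-refl))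
                          (trans (del-head x (map f (range (suc x) r))) (trans (cong (del x) above-shifted) del-above)))))))
                     inserted
      where del-head : ∀ x L → del x (x ∷ L) ≡ del x L
            del-head x L rewrite ≡ᵇ-true {x} {x} refl = refl
    rhs : range 1 x′ ++ (range (suc x′) (suc k′) ++ range (2 + x′ + k′) r) ≡ range 1 (suc x′ + r + suc k′ ∸ 1)
    rhs = sym (trans (cong (range 1) length-eq) (trans (range-++ 1 x′ (suc k′ + r))
           (cong (range 1 x′ ++_) (trans (range-++ (suc x′) (suc k′) r) (cong (λ a → range (suc x′) (suc k′) ++ range a r) (+-suc (suc x′) k′))))))
      where
        length-eq : suc x′ + r + suc k′ ∸ 1 ≡ x′ + (suc k′ + r)
        length-eq = trans (+-assoc x′ r (suc k′)) (cong (x′ +_) (+-comm r (suc k′)))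

compose-closed-normal : ∀ x′ r k′ {T₁ T₂} → BWTSL (suc x′ + r) T₁ → BWTSL (suc k′) T₂ →
          BWTSL (suc x′ + r + suc k′ ∸ 1) (compose T₁ (suc x′) (suc k′) T₂)
compose-closed-normal x′ r k′ {T₁} {T₂} v₁ v₂ =
  ↭-trans (↭-reflexive (cong labels eqC))
   (↭-trans (labels-graft x T₂′ T₁′ (distinct-shifted x (suc k′) (s≤s z≤n) v₁) (elem-shifted x (suc k′) v₁ (s≤s z≤n) (s≤s (m≤m+n x′ r))))
   (↭-trans (PPP.++⁺ (del-cong x (labels-shifted x (suc k′) v₁))
                      (↭-trans (↭-reflexive (labels-relabel (offset x) T₂)) (PPP.map⁺ (offset x) (valid-labels v₂))))
   (↭-trans (labels-compose-range x′ r k′) (↭-reflexive (sym (oneTo≡range _)))))) ,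
  subst Branching (sym eqC) (branching-graft x T₂′ T₁′ (branching-relabel (offset x) (proj₂ v₂)) (distinct-shifted x (suc k′) (s≤s z≤n) v₁)
                                 (branching-relabel (shiftAbove x (suc k′)) (proj₂ v₁)))
  where
    x = suc x′
    T₂′ = relabel (offset x) T₂
    T₁′ = relabel (shiftAbove x (suc k′)) T₁
    eqC = compose≡graft T₁ x (suc k′) T₂ (s≤s z≤n)

compose-closed : ∀ {m k T₁ T₂ x} → BWTSL m T₁ → BWTSL k T₂ → 1 ≤ x → x ≤ m → BWTSL (m + k ∸ 1) (compose T₁ x k T₂)
compose-closed {k = zero} v₁ v₂ p q = ⊥-elim (no-valid-tree-of-weight-0 v₂)
compose-closed {m} {suc k′} {T₁} {T₂} {suc x′} v₁ v₂ (s≤s z≤n) q =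
  subst (λ M → BWTSL (M + suc k′ ∸ 1) (compose T₁ (suc x′) (suc k′) T₂)) e
    (compose-closed-normal x′ (m ∸ suc x′) k′ (subst (λ M → BWTSL M T₁) (sym e) v₁) v₂)
  where e : suc x′ + (m ∸ suc x′) ≡ m
        e = m+[n∸m]≡n q

graft-unitTree : ∀ S → graft 1 S unitTree ≡ S
graft-unitTree (node L C) with isRed (node L C)
... | true = refl
... | false = refl

relabel-offset-1 : ∀ T → relabel (offset 1) T ≡ T
relabel-offset-1 T = trans (relabel-ext T (All.universal (λ y → m+n∸n≡m y 1) (labels T))) (relabel-id T)

compose-unit-left : ∀ k T → compose unitTree 1 k T ≡ T
compose-unit-left k T = trans (graft-unitTree (relabel (offset 1) T)) (relabel-offset-1 T)

mutual
  substW-unit : ∀ x T → Distinct (labels T) → substW x (x ∷ []) [] T ≅ T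
  substW-unit x (node L C) u with elem x L in e
  ... | true = node≅ (↭-trans (PPP.++-comm (del x L) (x ∷ [])) (↭-sym (↭-del x L (Distinct-++ˡ L _ u) e)))
                     (~-reflexive (++-identityʳ C))
  ... | false = node≅ ↭-refl (H.refl (substWF-unit x C (Distinct-++ʳ L _ u)))

  substWF-unit : ∀ x C → Distinct (labelsF C) → Pointwise _≅_ (substWF x (x ∷ []) [] C) C
  substWF-unit x [] u = []
  substWF-unit x (t ∷ C) u = substW-unit x t (Distinct-++ˡ (labels t) _ u) ∷ substWF-unit x C (Distinct-++ʳ (labels t) _ u)

compose-unit-right : ∀ {m T x} → BWTSL m T → compose T x 1 unitTree ≅ T
compose-unit-right {m} {T} {x} v =
  ≅-trans (≡⇒≅ (cong (substW x (x ∷ []) []) (trans (relabel-ext T (All.universal (shiftAbove-1 x) (labels T))) (relabel-id T))))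
          (substW-unit x T (valid-distinct v))

elem-del-map-avoid : ∀ (f : ℕ → ℕ) x y L → (∀ z → z ≢ x → f z ≢ y) → f x ≡ x → elem y (del x (map f L)) ≡ false
elem-del-map-avoid f x y L h fx with y ≟ x
... | yes refl = elem-del-self x (map f L)
... | no ne = trans (elem-del-other x y (map f L) ne) (elem-map-false f y L (All.universal pt L))
  where pt : ∀ z → f z ≢ y
        pt z with z ≟ x
        ... | yes refl = λ e → ne (trans (sym e) fx)
        ... | no n = h z n

-- In the host tree of the outer composite, the label y occurs only inside T₂.
elem-del-shifted : ∀ {m T₁} a d k′ l′ → BWTSL m T₁ → d ≤ k′ →
        elem (suc a + d) (del (suc a) (labels (relabel (shiftAbove (suc a) (suc k′ + suc l′ ∸ 1)) T₁))) ≡ false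
elem-del-shifted {m} {T₁} a d k′ l′ v dk =
  subst (λ L → elem (suc a + d) (del (suc a) L) ≡ false) (sym (labels-relabel f T₁))
    (elem-del-map-avoid f (suc a) (suc a + d) (labels T₁) pt (shiftAbove-≤ (suc a) _ (suc a) ≤-refl))
  where
    f = shiftAbove (suc a) (suc k′ + suc l′ ∸ 1)
    pt : ∀ z → z ≢ suc a → f z ≢ suc a + d
    pt z n e with z ≤? suc a
    ... | yes p = <⇒≱ (≤∧≢⇒< p n) (≤-trans (m≤m+n (suc a) d) (≤-reflexive (sym (trans (sym (shiftAbove-≤ (suc a) _ z p)) e))))
    ... | no p = <⇒≢ lt (sym (trans (sym (shiftAbove-> (suc a) _ z (≰⇒> p))) e))
      where
        lt : suc a + d < z + (k′ + suc l′) ∸ 1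
        lt = subst (suc a + d <_) (sym (trans (cong (λ w → z + w ∸ 1) (+-suc k′ l′)) (+suc∸1 z (k′ + l′))))
               (≤-<-trans (+-monoʳ-≤ (suc a) dk) (<-≤-trans (+-monoˡ-< k′ (≰⇒> p)) (≤-trans (m≤m+n (z + k′) l′) (≤-reflexive (+-assoc z k′ l′)))))

compose-assoc-seq-normal : ∀ a d k′ l′ {m T₁ T₂ T₃} → BWTSL m T₁ → BWTSL (suc k′) T₂ → BWTSL (suc l′) T₃ → d ≤ k′ →
  compose (compose T₁ (suc a) (suc k′) T₂) (suc a + d) (suc l′) T₃
    ≡ compose T₁ (suc a) (suc k′ + suc l′ ∸ 1) (compose T₂ (suc d) (suc l′) T₃)
compose-assoc-seq-normal a d k′ l′ {m} {T₁} {T₂} {T₃} v₁ v₂ v₃ d≤k′ = begin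
    compose (compose T₁ x k T₂) y l T₃
  ≡⟨ compose-compose T₁ T₂ T₃ x k y l v₁ (s≤s z≤n) (s≤s z≤n) ⟩
    graft y S₃ (graft (shiftAbove y l x) (relabel (shiftAbove y l ∘ offset x) T₂) (relabel (shiftAbove y l ∘ shiftAbove x k) T₁))
  ≡⟨ cong (graft y S₃) (cong-graft (shiftAbove-≤ y l x (m≤m+n x d))
                                    (relabel-pointwise _ _ T₂ (shiftAbove-offset a d l′))
                                    (relabel-pointwise _ _ T₁ (shiftAbove-shiftAbove a d k′ l′ d≤k′))) ⟩
    graft y S₃ (graft x S₂ T′)
  ≡⟨ graft-sequential x y S₂ S₃ T′ (distinct-shifted x K K≥1 v₁) (elem-del-shifted a d k′ l′ v₁ d≤k′) ⟩
    graft x (graft y S₃ S₂) T′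
  ≡⟨ cong (λ U → graft x U T′) (cong-graft {T = S₂} (+-comm d x) (relabel-pointwise _ _ T₃ (λ z → sym (offset-offset a d z))) refl) ⟨
    graft x (graft (offset x (suc d)) (relabel (offset x ∘ offset (suc d)) T₃) S₂) T′
  ≡⟨ cong (λ U → graft x U T′) (relabel-compose (offset x) (suc d) l T₂ T₃ (offset-injective x (s≤s z≤n)) (s≤s z≤n) v₂) ⟨
    graft x (relabel (offset x) (compose T₂ (suc d) l T₃)) T′
  ≡⟨ compose≡graft T₁ x K (compose T₂ (suc d) l T₃) K≥1 ⟨
    compose T₁ x K (compose T₂ (suc d) l T₃)
  ∎
  where
    open ≡-Reasoning
    x = suc a
    y = suc a + d
    k = suc k′
    l = suc l′
    K = suc k′ + suc l′ ∸ 1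
    K≥1 : 1 ≤ K
    K≥1 = ≤-trans (s≤s z≤n) (m≤n+m (suc l′) k′)
    S₂ = relabel (offset x ∘ shiftAbove (suc d) l) T₂
    S₃ = relabel (offset y) T₃
    T′ = relabel (shiftAbove x K) T₁

compose-assoc-seq : ∀ {m k l T₁ T₂ T₃ x y} → BWTSL m T₁ → BWTSL k T₂ → BWTSL l T₃ →
           1 ≤ x → x ≤ m → x ≤ y → y < x + k →
           compose (compose T₁ x k T₂) y l T₃ ≅ compose T₁ x (k + l ∸ 1) (compose T₂ (y ∸ x + 1) l T₃)
compose-assoc-seq {k = zero} v₁ v₂ v₃ p q r s = ⊥-elim (no-valid-tree-of-weight-0 v₂)
compose-assoc-seq {k = suc _} {l = zero} v₁ v₂ v₃ p q r s = ⊥-elim (no-valid-tree-of-weight-0 v₃)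
compose-assoc-seq {m} {suc k′} {suc l′} {T₁} {T₂} {T₃} {suc a} {y} v₁ v₂ v₃ (s≤s z≤n) q r s =
  ≡⇒≅ (subst (λ Y → compose (compose T₁ (suc a) (suc k′) T₂) Y (suc l′) T₃
                     ≡ compose T₁ (suc a) (suc k′ + suc l′ ∸ 1) (compose T₂ (Y ∸ suc a + 1) (suc l′) T₃)) e
         (trans (compose-assoc-seq-normal a d k′ l′ v₁ v₂ v₃ dk)
                (cong (λ z → compose T₁ (suc a) (suc k′ + suc l′ ∸ 1) (compose T₂ z (suc l′) T₃))
                      (trans (sym (+-comm d 1)) (cong (_+ 1) (sym (m+n∸m≡n (suc a) d)))))))
  where
    d = y ∸ suc a
    e : suc a + d ≡ y
    e = m+[n∸m]≡n r
    dk : d ≤ k′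
    dk = s≤s⁻¹ (+-cancelˡ-< (suc a) d (suc k′) (subst (_< suc a + suc k′) (sym e) s))

offset-below : ∀ a k′ y z → suc a < y → z < 1 + suc k′ → offset (suc a) z < y + k′
offset-below a k′ y z x<y z≤k = subst (_< y + k′) (sym (+suc∸1 z a))
  (≤-<-trans (+-monoˡ-≤ a (s≤s⁻¹ z≤k)) (subst (_< y + k′) (cong suc (+-comm a k′)) (+-monoˡ-< k′ x<y)))

<-offset : ∀ x Y z → x < Y → 1 ≤ z → x < offset Y z
<-offset x Y (suc z) x<Y _ = <-≤-trans x<Y (m≤n+m Y z)

shiftAbove-offset-above : ∀ x k′ y z → x < y → 1 ≤ z → shiftAbove x (suc k′) (offset y z) ≡ offset (y + k′) z
shiftAbove-offset-above x k′ y (suc z) x<y _ =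
  trans (shiftAbove-> x (suc k′) (offset y (suc z)) (<-≤-trans x<y (m≤n+m y z)))
        (trans (+suc∸1 (z + y) k′) (+-assoc z y k′))

compose-assoc-par-normal : ∀ a k′ l′ y {m T₁ T₂ T₃} → BWTSL m T₁ → BWTSL (suc k′) T₂ → BWTSL (suc l′) T₃ → suc a < y → y ≤ m →
  compose (compose T₁ (suc a) (suc k′) T₂) (y + k′) (suc l′) T₃ ≅ compose (compose T₁ y (suc l′) T₃) (suc a) (suc k′) T₂
compose-assoc-par-normal a k′ l′ y {m} {T₁} {T₂} {T₃} v₁ v₂ v₃ x<y y≤m = begin
    compose (compose T₁ x k T₂) Y l T₃
  ≡⟨ compose-compose T₁ T₂ T₃ x k Y l v₁ (s≤s z≤n) (s≤s z≤n) ⟩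
    graft Y S₃ (graft (shiftAbove Y l x) (relabel (shiftAbove Y l ∘ offset x) T₂) (relabel (shiftAbove Y l ∘ shiftAbove x k) T₁))
  ≡⟨ cong (graft Y S₃) (cong-graft (shiftAbove-≤ Y l x (<⇒≤ x<Y))
        (relabel-on-labels _ _ _ T₂ (valid-bounds v₂) (λ z (_ , q) → shiftAbove-≤ Y l (offset x z) (<⇒≤ (offset-below a k′ y z x<y q))))
        (relabel-pointwise _ _ T₁ (shiftAbove-comm a k′ l′ y x<y))) ⟩
    graft Y S₃ (graft x S₂ T′)
  ≈⟨ graft-parallel x Y S₂ S₃ T′ (<⇒≢ x<Y) x∈T Y∈T Y∉S₂ x∉S₃ (branching-relabel _ (proj₂ v₂)) (branching-relabel _ (proj₂ v₃)) ⟩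
    graft x S₂ (graft Y S₃ T′)
  ≡⟨ cong (graft x S₂) (cong-graft (trans (shiftAbove-> x k y x<y) (+suc∸1 y k′))
        (relabel-on-labels _ _ _ T₃ (valid-bounds v₃) (λ z (p , _) → shiftAbove-offset-above x k′ y z x<y p)) (refl {x = T′})) ⟨
    graft x S₂ (graft (shiftAbove x k y) (relabel (shiftAbove x k ∘ offset y) T₃) (relabel (shiftAbove x k ∘ shiftAbove y l) T₁))
  ≡⟨ compose-compose T₁ T₃ T₂ y l x k v₁ (s≤s z≤n) (s≤s z≤n) ⟨
    compose (compose T₁ y l T₃) x k T₂
  ∎
  where
    open ≅-Reasoning
    x = suc a
    k = suc k′
    l = suc l′
    Y = y + k′
    x<Y : x < Y
    x<Y = <-≤-trans x<y (m≤m+n y k′)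
    S₂ = relabel (offset x) T₂
    S₃ = relabel (offset Y) T₃
    T′ = relabel (shiftAbove x k ∘ shiftAbove y l) T₁
    x∈T : elem x (labels T′) ≡ true
    x∈T = subst (λ w → elem w (labels T′) ≡ true)
            (trans (cong (shiftAbove x k) (shiftAbove-≤ y l x (<⇒≤ x<y))) (shiftAbove-≤ x k x ≤-refl))
            (elem-relabel _ T₁ x (valid-elem v₁ x (s≤s z≤n) (≤-trans (<⇒≤ x<y) y≤m)))
    Y∈T : elem Y (labels T′) ≡ true
    Y∈T = subst (λ w → elem w (labels T′) ≡ true)
            (trans (cong (shiftAbove x k) (shiftAbove-≤ y l y ≤-refl)) (trans (shiftAbove-> x k y x<y) (+suc∸1 y k′)))
            (elem-relabel _ T₁ y (valid-elem v₁ y (≤-trans (s≤s z≤n) x<y) y≤m))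
    Y∉S₂ : elem Y (labels S₂) ≡ false
    Y∉S₂ = elem-relabel-missed (offset x) _ T₂ Y (valid-bounds v₂) (λ z (_ , q) → <⇒≢ (offset-below a k′ y z x<y q))
    x∉S₃ : elem x (labels S₃) ≡ false
    x∉S₃ = elem-relabel-missed (offset Y) _ T₃ x (valid-bounds v₃) (λ z (p , _) e → <⇒≢ (<-offset x Y z x<Y p) (sym e))

compose-assoc-par : ∀ {m k l T₁ T₂ T₃ x y} → BWTSL m T₁ → BWTSL k T₂ → BWTSL l T₃ →
           1 ≤ x → x < y → y ≤ m →
           compose (compose T₁ x k T₂) (y + k ∸ 1) l T₃ ≅ compose (compose T₁ y l T₃) x k T₂
compose-assoc-par {k = zero} v₁ v₂ v₃ p q r = ⊥-elim (no-valid-tree-of-weight-0 v₂)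
compose-assoc-par {k = suc _} {l = zero} v₁ v₂ v₃ p q r = ⊥-elim (no-valid-tree-of-weight-0 v₃)
compose-assoc-par {m} {suc k′} {suc l′} {T₁} {T₂} {T₃} {suc a} {y} v₁ v₂ v₃ (s≤s z≤n) q r =
  subst (λ Y → compose (compose T₁ (suc a) (suc k′) T₂) Y (suc l′) T₃ ≅ compose (compose T₁ y (suc l′) T₃) (suc a) (suc k′) T₂)
        (sym (+suc∸1 y k′)) (compose-assoc-par-normal a k′ l′ y v₁ v₂ v₃ q r)

permLabel-inside : ∀ {n} (σ : Perm n) i (p : i < n) → permLabel σ (suc i) ≡ suc (toℕ (σ ⟨$⟩ʳ fromℕ< p))
permLabel-inside {n} σ i p with i <? n
... | yes q = refl
... | no q = ⊥-elim (q p)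

permLabel-outside : ∀ {n} (σ : Perm n) i → ¬ (i < n) → permLabel σ (suc i) ≡ suc i
permLabel-outside {n} σ i p with i <? n
... | yes q = ⊥-elim (p q)
... | no q = refl

permLabel-id : ∀ {n} z → permLabel (FP.id {n}) z ≡ z
permLabel-id zero = refl
permLabel-id {n} (suc i) with i <? n
... | yes p = cong suc (toℕ-fromℕ< p)
... | no p = refl

permLabel-∘ : ∀ {n} (σ τ : Perm n) z → permLabel (σ FP.∘ₚ τ) z ≡ permLabel τ (permLabel σ z)
permLabel-∘ σ τ zero = refl
permLabel-∘ {n} σ τ (suc i) with i <? n
... | no p = sym (permLabel-outside τ i p)
... | yes p = sym (trans (permLabel-inside τ _ (toℕ<n (σ ⟨$⟩ʳ fromℕ< p)))
                 (cong (λ j → suc (toℕ (τ ⟨$⟩ʳ j))) (fromℕ<-toℕ (σ ⟨$⟩ʳ fromℕ< p) (toℕ<n _))))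

permLabel-injective : ∀ {n} (σ : Perm n) a b → permLabel σ a ≡ permLabel σ b → a ≡ b
permLabel-injective σ zero zero e = refl
permLabel-injective {n} σ zero (suc j) e with j <? n
... | yes _ = ⊥-elim (0≢1+n e)
... | no _ = ⊥-elim (0≢1+n e)
permLabel-injective {n} σ (suc i) zero e with i <? n
... | yes _ = ⊥-elim (0≢1+n (sym e))
... | no _ = ⊥-elim (0≢1+n (sym e))
permLabel-injective {n} σ (suc i) (suc j) e with i <? n | j <? n
... | yes p | yes q = cong suc (trans (sym (toℕ-fromℕ< p)) (trans (cong toℕ fe) (toℕ-fromℕ< q)))
  where
    fe : fromℕ< p ≡ fromℕ< q
    fe = trans (sym (inverseˡ σ)) (trans (cong (σ ⟨$⟩ˡ_) (toℕ-injective (suc-injective e))) (inverseˡ σ))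
... | yes p | no q = ⊥-elim (q (subst (_< n) (suc-injective e) (toℕ<n _)))
... | no p | yes q = ⊥-elim (p (subst (_< n) (sym (suc-injective e)) (toℕ<n _)))
... | no p | no q = e

permLabel-bounds : ∀ {n} (σ : Perm n) z → 1 ≤ z → z < 1 + n → 1 ≤ permLabel σ z × permLabel σ z < 1 + n
permLabel-bounds {n} σ (suc i) p q rewrite permLabel-inside σ i (s≤s⁻¹ q) = s≤s z≤n , s≤s (toℕ<n _)

permLabel-oneTo : ∀ {n} (σ : Perm n) → map (permLabel σ) (oneTo n) ↭ oneTo n
permLabel-oneTo {n} σ rewrite oneTo≡range n =
  distinct-↭ _ _ (Distinct-map _ (range 1 n) (permLabel-injective σ) (range-distinct 1 n)) (range-distinct 1 n) (trans (length-map _ (range 1 n)) refl)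
      (AllP.map⁺ (All.map (λ { {z} (p , q) → let (p′ , q′) = permLabel-bounds σ z p q in range-inside _ 1 n p′ q′ }) (range-bounds 1 n)))

act-valid : ∀ {n} (σ : Perm n) {T} → BWTSL n T → BWTSL n (act σ T)
act-valid {n} σ {T} v@(p , b) =
  ↭-trans (↭-reflexive (labels-relabel (permLabel σ) T)) (↭-trans (PPP.map⁺ (permLabel σ) p) (permLabel-oneTo σ)) ,
  branching-relabel (permLabel σ) b

act-identity : ∀ {n} {T} → act (FP.id {n}) T ≅ T
act-identity {n} {T} = ≡⇒≅ (trans (relabel-pointwise _ _ T permLabel-id) (relabel-id T))

act-composition : ∀ {n} (σ τ : Perm n) {T} → act (σ FP.∘ₚ τ) T ≅ act τ (act σ T)
act-composition σ τ {T} = ≡⇒≅ (trans (relabel-pointwise _ _ T (permLabel-∘ σ τ)) (sym (relabel-∘ (permLabel τ) (permLabel σ) T)))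

-- Relabelling a composite by the block permutation σ ∘ₓ τ is
-- naturality of grafting for the pair of maps (blockLabel σ x τ, hostLabel σ x k),
-- which agree on every label of the host tree except x.

blockLabel-below : ∀ {m k} (σ : Perm m) x (τ : Perm k) y → y < x → blockLabel σ x τ y ≡ shiftAbove (permLabel σ x) k (permLabel σ y)
blockLabel-below {m} {k} σ x τ y p with y <? x | y <? x + k
... | yes _ | _ = refl
... | no q | _ = ⊥-elim (q p)

blockLabel-inside : ∀ {m k} (σ : Perm m) x (τ : Perm k) y → ¬ (y < x) → y < x + k → blockLabel σ x τ y ≡ permLabel τ (y ∸ x + 1) + permLabel σ x ∸ 1
blockLabel-inside {m} {k} σ x τ y p q with y <? x | y <? x + k
... | yes r | _ = ⊥-elim (p r)
... | no _ | yes _ = refl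
... | no _ | no r = ⊥-elim (r q)

blockLabel-above : ∀ {m k} (σ : Perm m) x (τ : Perm k) y → ¬ (y < x) → ¬ (y < x + k) →
        blockLabel σ x τ y ≡ shiftAbove (permLabel σ x) k (permLabel σ (y ∸ (k ∸ 1)))
blockLabel-above {m} {k} σ x τ y p q with y <? x | y <? x + k
... | yes r | _ = ⊥-elim (p r)
... | no _ | yes r = ⊥-elim (q r)
... | no _ | no _ = refl

-- The map that acts like σ on the labels of the renumbered host tree.
hostLabel : ∀ {m} → Perm m → ℕ → ℕ → ℕ → ℕ
hostLabel σ x k w = shiftAbove (permLabel σ x) k (permLabel σ (unshiftAbove x k w))

hostLabel-shiftAbove : ∀ {m} (σ : Perm m) x k′ z →
                       hostLabel σ x (suc k′) (shiftAbove x (suc k′) z) ≡ shiftAbove (permLabel σ x) (suc k′) (permLabel σ z)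
hostLabel-shiftAbove σ x k′ z = cong (λ w → shiftAbove (permLabel σ x) (suc k′) (permLabel σ w)) (unshiftAbove-shiftAbove x k′ z)

hostLabel-self : ∀ {m} (σ : Perm m) x k′ → hostLabel σ x (suc k′) x ≡ permLabel σ x
hostLabel-self σ x k′ =
  trans (cong (hostLabel σ x (suc k′)) (sym (shiftAbove-≤ x (suc k′) x ≤-refl)))
        (trans (hostLabel-shiftAbove σ x k′ x) (shiftAbove-≤ (permLabel σ x) (suc k′) (permLabel σ x) ≤-refl))

blockLabel-shiftAbove : ∀ {m k′} (σ : Perm m) a (τ : Perm (suc k′)) z → shiftAbove (suc a) (suc k′) z ≢ suc a →
                        blockLabel σ (suc a) τ (shiftAbove (suc a) (suc k′) z)
                          ≡ shiftAbove (permLabel σ (suc a)) (suc k′) (permLabel σ z)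
blockLabel-shiftAbove {k′ = k′} σ a τ z z′≢x with z ≤? suc a
... | yes z≤x = trans (cong (blockLabel σ (suc a) τ) (shiftAbove-≤ (suc a) (suc k′) z z≤x))
                      (blockLabel-below σ (suc a) τ z (≤∧≢⇒< z≤x (λ e → z′≢x (trans (shiftAbove-≤ (suc a) (suc k′) z z≤x) e))))
... | no z≰x = trans (cong (blockLabel σ (suc a) τ) z′≡)
                     (trans (blockLabel-above σ (suc a) τ (z + k′) (λ q → <⇒≱ q (≤-trans (<⇒≤ x<z) (m≤m+n z k′)))
                                                               (λ q → <⇒≱ q (subst (_≤ z + k′) (sym (cong suc (+-suc a k′))) (+-monoˡ-≤ k′ x<z))))
                            (cong (λ w → shiftAbove (permLabel σ (suc a)) (suc k′) (permLabel σ w)) (m+n∸n≡m z k′)))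
  where
    x<z = ≰⇒> z≰x
    z′≡ : shiftAbove (suc a) (suc k′) z ≡ z + k′
    z′≡ = trans (shiftAbove-> (suc a) (suc k′) z x<z) (+suc∸1 z k′)

blockLabel-compatible : ∀ {m k′} (σ : Perm m) a (τ : Perm (suc k′)) z →
                        Compatible (blockLabel σ (suc a) τ) (hostLabel σ (suc a) (suc k′)) (suc a) (shiftAbove (suc a) (suc k′) z)
blockLabel-compatible {k′ = k′} σ a τ z =
  (λ z′≢x → trans (blockLabel-shiftAbove σ a τ z z′≢x) (sym (hostLabel-shiftAbove σ (suc a) k′ z))) ,
  (λ e → trans (cong (shiftAbove (suc a) (suc k′)) (z≡x e)) (shiftAbove-≤ (suc a) (suc k′) (suc a) ≤-refl))
  where
    X = permLabel σ (suc a)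
    z≡x : hostLabel σ (suc a) (suc k′) (shiftAbove (suc a) (suc k′) z) ≡ hostLabel σ (suc a) (suc k′) (suc a) → z ≡ suc a
    z≡x e = permLabel-injective σ z (suc a) (shiftAbove-injective X (suc k′) (s≤s z≤n) _ _
              (trans (sym (hostLabel-shiftAbove σ (suc a) k′ z))
                     (trans e (trans (hostLabel-self σ (suc a) k′) (sym (shiftAbove-≤ X (suc k′) X ≤-refl))))))

blockLabel-offset : ∀ {m k′} (σ : Perm m) a (τ : Perm (suc k′)) z → 1 ≤ z → z < 1 + suc k′ →
                    blockLabel σ (suc a) τ (offset (suc a) z) ≡ offset (permLabel σ (suc a)) (permLabel τ z)
blockLabel-offset {k′ = k′} σ a τ (suc z) _ z≤k =
  trans (cong (blockLabel σ (suc a) τ) (+suc∸1 (suc z) a))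
        (trans (blockLabel-inside σ (suc a) τ (suc z + a) (λ r → <⇒≱ r (s≤s (m≤n+m a z)))
                                 (subst (suc z + a <_) (cong suc (+-comm (suc k′) a)) (+-monoˡ-< a z≤k)))
               (cong (λ w → permLabel τ w + permLabel σ (suc a) ∸ 1) back))
  where
    back : suc z + a ∸ suc a + 1 ≡ suc z
    back = trans (cong (λ w → w ∸ suc a + 1) (+-comm (suc z) a))
                 (trans (cong (_+ 1) (trans (cong (_∸ suc a) (+-suc a z)) (m+n∸m≡n a z))) (+-comm z 1))

compose-equivariant-normal : ∀ {m} a k′ {T₁ T₂} (σ : Perm m) (τ : Perm (suc k′)) → BWTSL m T₁ → BWTSL (suc k′) T₂ →
         compose (act σ T₁) (permLabel σ (suc a)) (suc k′) (act τ T₂) ≡ relabel (blockLabel σ (suc a) τ) (compose T₁ (suc a) (suc k′) T₂)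
compose-equivariant-normal {m} a k′ {T₁} {T₂} σ τ v₁ v₂ = begin
    compose (act σ T₁) X k (act τ T₂)
  ≡⟨ compose≡graft (act σ T₁) X k (act τ T₂) (s≤s z≤n) ⟩
    graft X (relabel (offset X) (relabel (permLabel τ) T₂)) (relabel (shiftAbove X k) (relabel (permLabel σ) T₁))
  ≡⟨ cong-graft (hostLabel-self σ x k′)
       (trans (relabel-∘ B (offset x) T₂)
              (trans (relabel-on-labels _ _ _ T₂ (valid-bounds v₂) (λ z (p , q) → blockLabel-offset σ a τ z p q))
                     (sym (relabel-∘ (offset X) (permLabel τ) T₂))))
       (trans (relabel-∘-pointwise G (shiftAbove x k) (shiftAbove X k ∘ permLabel σ) T₁ (hostLabel-shiftAbove σ x k′))
              (sym (relabel-∘ (shiftAbove X k) (permLabel σ) T₁))) ⟨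
    graft (G x) (relabel B (relabel (offset x) T₂)) (relabel G (relabel (shiftAbove x k) T₁))
  ≡⟨ relabel-graft B G x (relabel (offset x) T₂) (relabel (shiftAbove x k) T₁) (distinct-shifted x k (s≤s z≤n) v₁)
        (subst (All (Compatible B G x)) (sym (labels-relabel (shiftAbove x k) T₁))
               (AllP.map⁺ (All.universal (blockLabel-compatible σ a τ) (labels T₁)))) ⟨
    relabel B (graft x (relabel (offset x) T₂) (relabel (shiftAbove x k) T₁))
  ≡⟨ cong (relabel B) (compose≡graft T₁ x k T₂ (s≤s z≤n)) ⟨
    relabel B (compose T₁ x k T₂)
  ∎
  where
    open ≡-Reasoning
    x = suc a
    k = suc k′
    X = permLabel σ x
    B = blockLabel σ x τ
    G = hostLabel σ x k

compose-equivariant : ∀ {m k T₁ T₂ x} (σ : Perm m) (τ : Perm k) →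
                BWTSL m T₁ → BWTSL k T₂ → 1 ≤ x → x ≤ m →
                compose (act σ T₁) (permLabel σ x) k (act τ T₂) ≅ relabel (blockLabel σ x τ) (compose T₁ x k T₂)
compose-equivariant {k = zero} σ τ v₁ v₂ p q = ⊥-elim (no-valid-tree-of-weight-0 v₂)
compose-equivariant {m} {suc k′} {x = suc a} σ τ v₁ v₂ (s≤s z≤n) q = ≡⇒≅ (compose-equivariant-normal a k′ σ τ v₁ v₂)

compose-cong : ∀ {k T₁ T₁′ T₂ T₂′ x} → BWTSL k T₂ → T₁ ≅ T₁′ → T₂ ≅ T₂′ → compose T₁ x k T₂ ≅ compose T₁′ x k T₂′
compose-cong {k} {T₁} {T₁′} {T₂} {T₂′} {x} v₂ e₁ e₂ = begin
    compose T₁ x k T₂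
  ≡⟨ compose≡graft T₁ x k T₂ (valid-weight-positive v₂) ⟩
    graft x (relabel (offset x) T₂) (relabel (shiftAbove x k) T₁)
  ≈⟨ graft-cong x (relabel-cong (offset x) e₂) (relabel-cong (shiftAbove x k) e₁) ⟩
    graft x (relabel (offset x) T₂′) (relabel (shiftAbove x k) T₁′)
  ≡⟨ compose≡graft T₁′ x k T₂′ (valid-weight-positive v₂) ⟨
    compose T₁′ x k T₂′
  ∎
  where open ≅-Reasoning

unitTree-valid : BWTSL 1 unitTree
unitTree-valid = ↭-refl , branching (λ ()) []

mainTheorem5 : IsSymmetricSetOperad
mainTheorem5 = record
  { act-closed   = act-valid
  ; act-cong     = λ σ _ e → relabel-cong (permLabel σ) e
  ; act-id       = λ _ → act-identity
  ; act-∘        = λ σ τ _ → act-composition σ τ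
  ; comp-closed  = compose-closed
  ; comp-cong    = λ _ v₂ _ _ → compose-cong v₂
  ; unit-valid   = unitTree-valid
  ; unit-left    = λ {k} {T} _ → ≡⇒≅ (compose-unit-left k T)
  ; unit-right   = λ v _ _ → compose-unit-right v
  ; assoc-seq    = compose-assoc-seq
  ; assoc-par    = compose-assoc-par
  ; equivariance = compose-equivariant
  }
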